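{- There exist absolute constants $C>0$ and $c>0$ such that the following holds. Let $q$ be a prime power, $G=\mathrm{SL}(2,q)$, and $v,w\in\mathbb{F}_q$. Suppose that either (i) $q$ is even, or (ii) $q$ is odd, $(v^2,w^2)\ne(-4,-4)$ and $(v,w)\ne(0,0)$. Let $D$ be the distribution of \[\mathrm{Tr}\left(\begin{pmatrix}0&1\\1&w\end{pmatrix}u^{ -1}\begin{pmatrix}v&1\\1&0\end{pmatrix}u\right)\] for $u$ uniform in $G$. Then (1) $D$ takes every value $x\in\mathbb{F}_q$ with probability at most $C/q$, and (2) $D$ is within statistical distance $Cq^{ -c}$ of the uniform distribution on $\mathbb{F}_q$.
   Context: $\mathrm{Tr}$ is the trace of a $2\times2$ matrix over $\mathbb{F}_q$. The paper writes the bounds as $O(1/q)$ and $1/q^{\Omega(1)}$. -}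

module Defs where

open import Level using (0ℓ)
open import Data.Nat as ℕ using (ℕ; zero; suc; ∣_-_∣)
open import Data.Fin using (Fin)
open import Data.List using (List; map; concatMap; filter; length; allFin)
open import Data.Nat.ListAction using (sum)
open import Data.Product using (Σ; ∃; _×_; _,_)
open import Relation.Nullary using (¬_; Dec; yes; no)
open import Relation.Nullary.Decidable using (_×-dec_)
open import Relation.Binary.PropositionalEquality using (_≡_; _≢_)
open import Relation.Binary.Definitions using (DecidableEquality)
open import Algebra.Structures using (IsCommutativeRing)
open import Function.Bundles using (_↔_; Inverse)

record FiniteField : Set₁ where
  infixl 6 _+_
  infixl 7 _*_
  field
    Carrier : Set
    _+_ _*_ : Carrier → Carrier → Carrier
    -_ : Carrier → Carrier
    0# 1# : Carrier
    isCommutativeRing : IsCommutativeRing _≡_ _+_ _*_ -_ 0# 1#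
    0≢1 : 0# ≢ 1#
    inverse : ∀ x → x ≢ 0# → Σ Carrier (λ y → x * y ≡ 1#)
    size : ℕ
    enum : Carrier ↔ Fin size
    _≟_ : DecidableEquality Carrier

module _ (F : FiniteField) where
  open FiniteField F

  record Mat2 : Set where
    constructor mat
    field a b c d : Carrier

  _·_ : Mat2 → Mat2 → Mat2
  mat a b c d · mat a' b' c' d' =
    mat (a * a' + b * c') (a * b' + b * d') (c * a' + d * c') (c * b' + d * d')

  tr : Mat2 → Carrier
  tr (mat a b c d) = a + d

  det : Mat2 → Carrier
  det (mat a b c d) = a * d + - (b * c)

  invSL : Mat2 → Mat2
  invSL (mat a b c d) = mat d (- b) (- c) a

  elems : List Carrier
  elems = map (Inverse.from enum) (allFin size)

  allMat : List Mat2
  allMat = concatMap (λ a → concatMap (λ b → concatMap (λ c →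
             map (λ d → mat a b c d) elems) elems) elems) elems

  SL2 : List Mat2
  SL2 = filter (λ u → det u ≟ 1#) allMat

  orderSL2 : ℕ
  orderSL2 = length SL2

  trWord : Carrier → Carrier → Mat2 → Carrier
  trWord v w u = tr (mat 0# 1# 1# w · (invSL u · (mat v 1# 1# 0# · u)))

  -- number of u ∈ G with trWord v w u = x;  D(x) = countD v w x / |G|
  countD : Carrier → Carrier → Carrier → ℕ
  countD v w x = length (filter (λ u → trWord v w u ≟ x) SL2)

  -- Σ_x | q·countD(x) − |G| |.  The statistical (total variation) distance
  -- between D and the uniform distribution on F is
  --   (1/2) Σ_x |countD(x)/|G| − 1/q| = scaledTV v w / (2·q·|G|).
  scaledTV : Carrier → Carrier → ℕ
  scaledTV v w = sum (map (λ x → ∣ size ℕ.* countD v w x - orderSL2 ∣) elems)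

  four : Carrier
  four = 1# + 1# + 1# + 1#

module Submission where

-- Proof.  φ_v(u) = u⁻¹ J_v u has trace v and determinant −1, so when
-- Tr(W_w φ_v(u)) = x it is determined by its first row, a point of the conic
-- K_{v,w,x−wv} = 0; hence N(x) = #{u : D = x} ≤ (fibre of φ_v) · #K.  A fibre
-- of φ_v is a coset of the centraliser of J_v, parametrised by K_{0,v,0}.
-- Every conic has ≤ 2q points, a nondegenerate one ≤ q + 2 (a point is fixed by
-- the slope of its chord to a known point), and K_{v,w,x−wv} is degenerate for
-- at most two x.  With |SL(2,q)| ≥ q³ − q² this bounds N(x) and Σ_x |q N(x) − |G||.

open import Defs
open import Data.Nat as ℕ using (ℕ; _^_; _≤_; z≤n; s≤s)
open import Data.Nat.Divisibility using (_∣_)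
open import Data.Product using (Σ; _×_; _,_)
open import Data.Sum using (_⊎_)
open import Relation.Nullary using (¬_)
open import Relation.Binary.PropositionalEquality using (_≡_)
open import Algebra.Bundles using (RawRing)

module FiniteSums where

  open import Data.Nat using (ℕ; _+_; _*_; _≤_; z≤n)
  open import Data.Nat.Properties
  open import Data.List using (List; []; _∷_; map; concatMap; filter; length; _++_)
  open import Data.Nat.ListAction using (sum)
  open import Data.List.Relation.Unary.Any using (Any; here; there; any?; satisfied)
  open import Data.Product using (proj₁; proj₂)
  open import Data.Empty using (⊥-elim)
  open import Relation.Nullary using (¬_; Dec; yes; no; ¬?)
  open import Relation.Nullary.Decidable using (_×-dec_)
  open import Relation.Binary.PropositionalEquality
  open ≡-Reasoning

  ∑ : {A : Set} → (A → ℕ) → List A → ℕ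
  ∑ f xs = sum (map f xs)

  𝟙 : {P : Set} → Dec P → ℕ
  𝟙 (yes _) = 1
  𝟙 (no _) = 0

  private
    variable
      P Q : Set

  𝟙-yes : (d : Dec P) → P → 𝟙 d ≡ 1
  𝟙-yes (yes _) _ = refl
  𝟙-yes (no ¬p) p = ⊥-elim (¬p p)

  𝟙-no : (d : Dec P) → ¬ P → 𝟙 d ≡ 0
  𝟙-no (yes p) ¬p = ⊥-elim (¬p p)
  𝟙-no (no _) _ = refl

  𝟙-mono : (d : Dec P) (e : Dec Q) → (P → Q) → 𝟙 d ≤ 𝟙 e
  𝟙-mono (yes p) (yes q) _ = ≤-refl
  𝟙-mono (yes p) (no ¬q) f = ⊥-elim (¬q (f p))
  𝟙-mono (no _) _ _ = z≤n

  𝟙-cong : (d : Dec P) (e : Dec Q) → (P → Q) → (Q → P) → 𝟙 d ≡ 𝟙 e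
  𝟙-cong d e f g = ≤-antisym (𝟙-mono d e f) (𝟙-mono e d g)

  𝟙-¬? : (d : Dec P) → 𝟙 d + 𝟙 (¬? d) ≡ 1
  𝟙-¬? (yes _) = refl
  𝟙-¬? (no _) = refl

  𝟙-× : (d : Dec P) (e : Dec Q) → 𝟙 (d ×-dec e) ≡ 𝟙 d * 𝟙 e
  𝟙-× (yes _) (yes _) = refl
  𝟙-× (yes _) (no _) = refl
  𝟙-× (no _) _ = refl

  𝟙-×³ : ∀ {R : Set} (d : Dec P) (e : Dec Q) (f : Dec R) → 𝟙 d * (𝟙 e * 𝟙 f) ≡ 𝟙 (d ×-dec (e ×-dec f))
  𝟙-×³ d e f = sym (trans (𝟙-× d (e ×-dec f)) (cong (𝟙 d *_) (𝟙-× e f)))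

  module _ {A : Set} where

    ∑-cong : ∀ {f g : A → ℕ} (xs : List A) → (∀ x → f x ≡ g x) → ∑ f xs ≡ ∑ g xs
    ∑-cong [] _ = refl
    ∑-cong (x ∷ xs) e = cong₂ _+_ (e x) (∑-cong xs e)

    ∑-mono : ∀ {f g : A → ℕ} (xs : List A) → (∀ x → f x ≤ g x) → ∑ f xs ≤ ∑ g xs
    ∑-mono [] _ = z≤n
    ∑-mono (x ∷ xs) e = +-mono-≤ (e x) (∑-mono xs e)

    ∑-+ : ∀ (f g : A → ℕ) (xs : List A) → ∑ (λ x → f x + g x) xs ≡ ∑ f xs + ∑ g xs
    ∑-+ f g [] = refl
    ∑-+ f g (x ∷ xs) = begin
      (f x + g x) + ∑ (λ x → f x + g x) xs   ≡⟨ cong ((f x + g x) +_) (∑-+ f g xs) ⟩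
      (f x + g x) + (∑ f xs + ∑ g xs)       ≡⟨ +-assoc (f x) (g x) _ ⟩
      f x + (g x + (∑ f xs + ∑ g xs))       ≡⟨ cong (f x +_) (+-comm (g x) _) ⟩
      f x + ((∑ f xs + ∑ g xs) + g x)       ≡⟨ cong (f x +_) (+-assoc (∑ f xs) _ _) ⟩
      f x + (∑ f xs + (∑ g xs + g x))       ≡⟨ sym (+-assoc (f x) _ _) ⟩
      (f x + ∑ f xs) + (∑ g xs + g x)       ≡⟨ cong ((f x + ∑ f xs) +_) (+-comm (∑ g xs) (g x)) ⟩
      (f x + ∑ f xs) + (g x + ∑ g xs)       ∎

    ∑-*ˡ : ∀ (c : ℕ) (f : A → ℕ) (xs : List A) → ∑ (λ x → c * f x) xs ≡ c * ∑ f xs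
    ∑-*ˡ c f [] = sym (*-zeroʳ c)
    ∑-*ˡ c f (x ∷ xs) = trans (cong (c * f x +_) (∑-*ˡ c f xs)) (sym (*-distribˡ-+ c (f x) (∑ f xs)))

    ∑-*ʳ : ∀ (c : ℕ) (f : A → ℕ) (xs : List A) → ∑ (λ x → f x * c) xs ≡ ∑ f xs * c
    ∑-*ʳ c f xs = begin
      ∑ (λ x → f x * c) xs  ≡⟨ ∑-cong xs (λ x → *-comm (f x) c) ⟩
      ∑ (λ x → c * f x) xs  ≡⟨ ∑-*ˡ c f xs ⟩
      c * ∑ f xs            ≡⟨ *-comm c (∑ f xs) ⟩
      ∑ f xs * c            ∎

    ∑-const : ∀ (c : ℕ) (xs : List A) → ∑ (λ _ → c) xs ≡ length xs * c
    ∑-const c [] = refl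
    ∑-const c (x ∷ xs) = cong (c +_) (∑-const c xs)

    ∑-zero : ∀ (f : A → ℕ) (xs : List A) → (∀ x → f x ≡ 0) → ∑ f xs ≡ 0
    ∑-zero f xs e = trans (∑-cong xs e) (trans (∑-const 0 xs) (*-zeroʳ (length xs)))

    ∑-++ : ∀ (f : A → ℕ) (xs ys : List A) → ∑ f (xs ++ ys) ≡ ∑ f xs + ∑ f ys
    ∑-++ f [] ys = refl
    ∑-++ f (x ∷ xs) ys = trans (cong (f x +_) (∑-++ f xs ys)) (sym (+-assoc (f x) _ _))

    ∑-map : ∀ {B : Set} (f : A → ℕ) (g : B → A) (ys : List B) → ∑ f (map g ys) ≡ ∑ (λ y → f (g y)) ys
    ∑-map f g [] = refl
    ∑-map f g (y ∷ ys) = cong (f (g y) +_) (∑-map f g ys)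

    ∑-concatMap : ∀ {B : Set} (f : A → ℕ) (g : B → List A) (ys : List B) →
      ∑ f (concatMap g ys) ≡ ∑ (λ y → ∑ f (g y)) ys
    ∑-concatMap f g [] = refl
    ∑-concatMap f g (y ∷ ys) = trans (∑-++ f (g y) (concatMap g ys)) (cong (∑ f (g y) +_) (∑-concatMap f g ys))

    ∑-filter : ∀ {P : A → Set} (P? : ∀ x → Dec (P x)) (f : A → ℕ) (xs : List A) →
      ∑ f (filter P? xs) ≡ ∑ (λ x → 𝟙 (P? x) * f x) xs
    ∑-filter P? f [] = refl
    ∑-filter P? f (x ∷ xs) with P? x
    ... | yes _ = cong₂ _+_ (sym (+-identityʳ (f x))) (∑-filter P? f xs)
    ... | no _ = ∑-filter P? f xs

    length-filter : ∀ {P : A → Set} (P? : ∀ x → Dec (P x)) (xs : List A) →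
      length (filter P? xs) ≡ ∑ (λ x → 𝟙 (P? x)) xs
    length-filter P? xs = begin
      length (filter P? xs)               ≡⟨ sym (trans (∑-const 1 (filter P? xs)) (*-identityʳ _)) ⟩
      ∑ (λ _ → 1) (filter P? xs)          ≡⟨ ∑-filter P? (λ _ → 1) xs ⟩
      ∑ (λ x → 𝟙 (P? x) * 1) xs           ≡⟨ ∑-cong xs (λ x → *-identityʳ (𝟙 (P? x))) ⟩
      ∑ (λ x → 𝟙 (P? x)) xs               ∎

    count-none : ∀ {P : A → Set} (P? : ∀ x → Dec (P x)) (xs : List A) →
      ¬ Any P xs → ∑ (λ x → 𝟙 (P? x)) xs ≡ 0
    count-none P? [] _ = refl
    count-none P? (x ∷ xs) none =
      cong₂ _+_ (𝟙-no (P? x) (λ p → none (here p))) (count-none P? xs (λ a → none (there a)))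

    count-from-witness : ∀ {P : A → Set} (P? : ∀ x → Dec (P x)) (xs : List A) (k : ℕ) →
      (∀ t → P t → ∑ (λ x → 𝟙 (P? x)) xs ≤ k) → ∑ (λ x → 𝟙 (P? x)) xs ≤ k
    count-from-witness P? xs k h with any? P? xs
    ... | yes some = h (proj₁ (satisfied some)) (proj₂ (satisfied some))
    ... | no none = subst (_≤ k) (sym (count-none P? xs none)) z≤n

  ∑-swap : ∀ {A B : Set} (h : A → B → ℕ) (xs : List A) (ys : List B) →
    ∑ (λ x → ∑ (h x) ys) xs ≡ ∑ (λ y → ∑ (λ x → h x y) xs) ys
  ∑-swap h [] ys = sym (∑-zero _ ys (λ _ → refl))
  ∑-swap h (x ∷ xs) ys = begin
    ∑ (h x) ys + ∑ (λ x → ∑ (h x) ys) xs               ≡⟨ cong (∑ (h x) ys +_) (∑-swap h xs ys) ⟩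
    ∑ (h x) ys + ∑ (λ y → ∑ (λ x → h x y) xs) ys       ≡⟨ sym (∑-+ (h x) _ ys) ⟩
    ∑ (λ y → h x y + ∑ (λ x → h x y) xs) ys            ∎

  ∑≤𝟙* : ∀ {A : Set} {h : A → ℕ} {f : ℕ} (xs : List A) (Q? : Dec Q) →
    (Q → ∑ h xs ≤ f) → (¬ Q → ∀ x → h x ≡ 0) → ∑ h xs ≤ 𝟙 Q? * f
  ∑≤𝟙* {f = f} xs (yes q) bounded _ = subst (_ ≤_) (sym (+-identityʳ f)) (bounded q)
  ∑≤𝟙* {h = h} xs (no ¬q) _ vanishes = ≤-reflexive (∑-zero h xs (vanishes ¬q))

module Enumerations where

  open import Data.Nat using (ℕ; zero; suc; _+_; _*_; _≤_; _<?_; z≤n; s≤s)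
  open import Data.Nat.Properties hiding (_≟_)
  open import Data.Fin as Fin using (Fin)
  open import Data.Fin.Properties as Fin using ()
  open import Data.List using (List; map; concatMap; allFin; tabulate)
  open import Data.Product using (_×_; _,_; proj₁; proj₂)
  open import Data.Product.Properties using (≡-dec)
  open import Data.Sum using (_⊎_; inj₁; inj₂)
  open import Data.Empty using (⊥-elim)
  open import Relation.Nullary using (Dec; yes; no; ¬?)
  open import Relation.Nullary.Decidable using (_×-dec_)
  open import Relation.Binary.PropositionalEquality
  open import Relation.Binary.Definitions using (DecidableEquality; tri<; tri≈; tri>)
  open import Function.Bundles using (_↔_; Inverse)
  open FiniteSums
  open ≡-Reasoning

  record Enumeration (T : Set) : Set where
    field
      list : List T
      _≟_ : DecidableEquality T
      once : ∀ t → ∑ (λ s → 𝟙 (t ≟ s)) list ≡ 1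

  module EnumerationProperties {T : Set} (E : Enumeration T) where
    open Enumeration E

    count : ∀ {P : T → Set} → (∀ t → Dec (P t)) → ℕ
    count P? = ∑ (λ s → 𝟙 (P? s)) list

    ∑-delta : ∀ t (g : T → ℕ) → ∑ (λ s → 𝟙 (t ≟ s) * g s) list ≡ g t
    ∑-delta t g = begin
      ∑ (λ s → 𝟙 (t ≟ s) * g s) list   ≡⟨ ∑-cong list delta-pointwise ⟩
      ∑ (λ s → 𝟙 (t ≟ s) * g t) list   ≡⟨ ∑-*ʳ (g t) _ list ⟩
      ∑ (λ s → 𝟙 (t ≟ s)) list * g t   ≡⟨ cong (_* g t) (once t) ⟩
      1 * g t                          ≡⟨ *-identityˡ (g t) ⟩
      g t                              ∎
      where
      delta-pointwise : ∀ s → 𝟙 (t ≟ s) * g s ≡ 𝟙 (t ≟ s) * g t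
      delta-pointwise s with t ≟ s
      ... | yes refl = refl
      ... | no _ = refl

    ∑-fibres : ∀ {U : Set} (L : List U) (κ : U → T) (h : U → ℕ) →
      ∑ h L ≡ ∑ (λ s → ∑ (λ u → 𝟙 (κ u ≟ s) * h u) L) list
    ∑-fibres L κ h = begin
      ∑ h L                                              ≡⟨ ∑-cong L (λ u → sym (∑-delta (κ u) (λ _ → h u))) ⟩
      ∑ (λ u → ∑ (λ s → 𝟙 (κ u ≟ s) * h u) list) L      ≡⟨ ∑-swap _ L list ⟩
      ∑ (λ s → ∑ (λ u → 𝟙 (κ u ≟ s) * h u) L) list      ∎

    count≤1 : ∀ {P : T → Set} (P? : ∀ t → Dec (P t)) → (∀ t t' → P t → P t' → t ≡ t') → count P? ≤ 1
    count≤1 P? unique = count-from-witness P? list 1 λ t₀ p₀ →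
      subst (count P? ≤_) (once t₀) (∑-mono list (λ s → 𝟙-mono (P? s) (t₀ ≟ s) (unique t₀ s p₀)))

    count≤𝟙 : ∀ {P : T → Set} {Q : Set} (P? : ∀ t → Dec (P t)) (Q? : Dec Q) →
      (∀ t t' → P t → P t' → t ≡ t') → (∀ t → P t → Q) → count P? ≤ 𝟙 Q?
    count≤𝟙 P? (yes _) unique _ = count≤1 P? unique
    count≤𝟙 P? (no ¬q) _ implies = count-from-witness P? list 0 (λ t p → ⊥-elim (¬q (implies t p)))

    count≤2 : ∀ {P : T → Set} (P? : ∀ t → Dec (P t)) (r₁ r₂ : T) →
      (∀ s → P s → r₁ ≡ s ⊎ r₂ ≡ s) → count P? ≤ 2
    count≤2 P? r₁ r₂ solutions =
      ≤-trans (∑-mono list covered) (≤-reflexive (trans (∑-+ _ _ list) (cong₂ _+_ (once r₁) (once r₂))))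
      where
      covered : ∀ s → 𝟙 (P? s) ≤ 𝟙 (r₁ ≟ s) + 𝟙 (r₂ ≟ s)
      covered s with P? s
      ... | no _ = z≤n
      ... | yes ps with solutions s ps
      ...   | inj₁ e = subst (λ z → 1 ≤ z + 𝟙 (r₂ ≟ s)) (sym (𝟙-yes (r₁ ≟ s) e)) (s≤s z≤n)
      ...   | inj₂ e = subst (λ z → 1 ≤ 𝟙 (r₁ ≟ s) + z) (sym (𝟙-yes (r₂ ≟ s) e)) (m≤n+m 1 (𝟙 (r₁ ≟ s)))

    ∑-bijection : (σ σ⁻¹ : T → T) → (∀ t → σ (σ⁻¹ t) ≡ t) → (∀ t → σ⁻¹ (σ t) ≡ t) → (g : T → ℕ) →
      ∑ (λ t → g (σ t)) list ≡ ∑ g list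
    ∑-bijection σ σ⁻¹ right left g = begin
      ∑ (λ t → g (σ t)) list                              ≡⟨ ∑-fibres list σ (λ t → g (σ t)) ⟩
      ∑ (λ s → ∑ (λ u → 𝟙 (σ u ≟ s) * g (σ u)) list) list ≡⟨ ∑-cong list (λ s → ∑-cong list (on-fibre s)) ⟩
      ∑ (λ s → ∑ (λ u → 𝟙 (σ u ≟ s) * g s) list) list     ≡⟨ ∑-cong list (λ s → ∑-*ʳ (g s) _ list) ⟩
      ∑ (λ s → ∑ (λ u → 𝟙 (σ u ≟ s)) list * g s) list     ≡⟨ ∑-cong list (λ s → cong (_* g s) (fibre-size s)) ⟩
      ∑ (λ s → 1 * g s) list                              ≡⟨ ∑-cong list (λ s → *-identityˡ (g s)) ⟩
      ∑ g list                                            ∎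
      where
      on-fibre : ∀ s u → 𝟙 (σ u ≟ s) * g (σ u) ≡ 𝟙 (σ u ≟ s) * g s
      on-fibre s u with σ u ≟ s
      ... | yes e = cong (λ z → 1 * g z) e
      ... | no _ = refl
      fibre-size : ∀ s → ∑ (λ u → 𝟙 (σ u ≟ s)) list ≡ 1
      fibre-size s = trans (∑-cong list (λ u → 𝟙-cong (σ u ≟ s) (σ⁻¹ s ≟ u)
                              (λ e → trans (cong σ⁻¹ (sym e)) (left u))
                              (λ e → trans (cong σ (sym e)) (right s))))
                           (once (σ⁻¹ s))

    -- An involution σ moves an even number of points: if ι : T → ℕ is injective,
    -- the moved points are the t with ι t < ι (σ t) together with their images.
    moved-points-even : (σ : T → T) → (∀ t → σ (σ t) ≡ t) → (ι : T → ℕ) → (∀ {t s} → ι t ≡ ι s → t ≡ s) →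
      count (λ t → ¬? (σ t ≟ t)) ≡ 2 * count (λ t → ι t <? ι (σ t))
    moved-points-even σ involutive ι ι-injective = begin
      count (λ t → ¬? (σ t ≟ t))                       ≡⟨ ∑-cong list moved-split ⟩
      ∑ (λ t → 𝟙 (ι t <? ι (σ t)) + 𝟙 (ι (σ t) <? ι (σ (σ t)))) list
        ≡⟨ ∑-+ _ _ list ⟩
      count (λ t → ι t <? ι (σ t)) + ∑ (λ t → 𝟙 (ι (σ t) <? ι (σ (σ t)))) list
        ≡⟨ cong (count (λ t → ι t <? ι (σ t)) +_) (∑-bijection σ σ involutive involutive (λ t → 𝟙 (ι t <? ι (σ t)))) ⟩
      count (λ t → ι t <? ι (σ t)) + count (λ t → ι t <? ι (σ t))
        ≡⟨ cong (count (λ t → ι t <? ι (σ t)) +_) (sym (+-identityʳ _)) ⟩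
      2 * count (λ t → ι t <? ι (σ t))                 ∎
      where
      moved-split : ∀ t → 𝟙 (¬? (σ t ≟ t)) ≡ 𝟙 (ι t <? ι (σ t)) + 𝟙 (ι (σ t) <? ι (σ (σ t)))
      moved-split t rewrite involutive t with <-cmp (ι t) (ι (σ t))
      ... | tri< lt _ gt̸ = trans (𝟙-yes (¬? (σ t ≟ t)) (λ e → <-irrefl (cong ι (sym e)) lt))
                                 (cong₂ _+_ (sym (𝟙-yes (ι t <? ι (σ t)) lt)) (sym (𝟙-no (ι (σ t) <? ι t) gt̸)))
      ... | tri≈ lt̸ eq gt̸ = trans (𝟙-no (¬? (σ t ≟ t)) (λ moved → moved (ι-injective (sym eq))))
                                 (cong₂ _+_ (sym (𝟙-no (ι t <? ι (σ t)) lt̸)) (sym (𝟙-no (ι (σ t) <? ι t) gt̸)))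
      ... | tri> lt̸ _ gt = trans (𝟙-yes (¬? (σ t ≟ t)) (λ e → <-irrefl (cong ι e) gt))
                                 (cong₂ _+_ (sym (𝟙-no (ι t <? ι (σ t)) lt̸)) (sym (𝟙-yes (ι (σ t) <? ι t) gt)))

  Fin-enumeration : ∀ n → Enumeration (Fin n)
  Fin-enumeration n = record { list = allFin n ; _≟_ = Fin._≟_ ; once = once n }
    where
    ∑-tabulate : ∀ {A : Set} m (h : A → ℕ) (f : Fin m → A) → ∑ h (tabulate f) ≡ ∑ (λ i → h (f i)) (allFin m)
    ∑-tabulate zero h f = refl
    ∑-tabulate (suc m) h f =
      cong (h (f Fin.zero) +_) (trans (∑-tabulate m h (λ i → f (Fin.suc i))) (sym (∑-tabulate m (λ i → h (f i)) Fin.suc)))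
    once : ∀ m (j : Fin m) → ∑ (λ i → 𝟙 (j Fin.≟ i)) (allFin m) ≡ 1
    once (suc m) Fin.zero =
      cong suc (trans (∑-tabulate m (λ i → 𝟙 (Fin.zero Fin.≟ i)) Fin.suc) (∑-zero _ (allFin m) (λ _ → refl)))
    once (suc m) (Fin.suc j) = begin
      ∑ (λ i → 𝟙 (Fin.suc j Fin.≟ i)) (allFin (suc m))           ≡⟨ ∑-tabulate m (λ i → 𝟙 (Fin.suc j Fin.≟ i)) Fin.suc ⟩
      ∑ (λ i → 𝟙 (Fin.suc j Fin.≟ Fin.suc i)) (allFin m)
        ≡⟨ ∑-cong (allFin m) (λ i → 𝟙-cong (Fin.suc j Fin.≟ Fin.suc i) (j Fin.≟ i) Fin.suc-injective (cong Fin.suc)) ⟩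
      ∑ (λ i → 𝟙 (j Fin.≟ i)) (allFin m)                         ≡⟨ once m j ⟩
      1                                                          ∎

  ↔-enumeration : ∀ {A B : Set} → A ↔ B → DecidableEquality A → Enumeration B → Enumeration A
  ↔-enumeration {A} e _≟A_ EB = record { list = map from (Enumeration.list EB) ; _≟_ = _≟A_ ; once = once }
    where
    open Inverse e using (to; from; inverseˡ; inverseʳ)
    open Enumeration EB using () renaming (_≟_ to _≟B_)
    once : ∀ t → ∑ (λ s → 𝟙 (t ≟A s)) (map from (Enumeration.list EB)) ≡ 1
    once t = begin
      ∑ (λ s → 𝟙 (t ≟A s)) (map from (Enumeration.list EB))  ≡⟨ ∑-map _ from (Enumeration.list EB) ⟩
      ∑ (λ i → 𝟙 (t ≟A from i)) (Enumeration.list EB)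
        ≡⟨ ∑-cong (Enumeration.list EB) (λ i → 𝟙-cong (t ≟A from i) (to t ≟B i) inverseˡ (λ e → sym (inverseʳ (sym e)))) ⟩
      ∑ (λ i → 𝟙 (to t ≟B i)) (Enumeration.list EB)          ≡⟨ Enumeration.once EB (to t) ⟩
      1                                                      ∎

  ×-enumeration : ∀ {A B : Set} → Enumeration A → Enumeration B → Enumeration (A × B)
  ×-enumeration {A} {B} EA EB = record { list = pairs ; _≟_ = ≡-dec _≟A_ _≟B_ ; once = once }
    where
    open Enumeration EA renaming (list to as; _≟_ to _≟A_; once to onceA)
    open Enumeration EB renaming (list to bs; _≟_ to _≟B_; once to onceB)
    pairs : List (A × B)
    pairs = concatMap (λ a → map (a ,_) bs) as
    𝟙-pair : ∀ a a' b b' → 𝟙 (≡-dec _≟A_ _≟B_ (a , b) (a' , b')) ≡ 𝟙 (a ≟A a') * 𝟙 (b ≟B b')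
    𝟙-pair a a' b b' = trans (𝟙-cong (≡-dec _≟A_ _≟B_ (a , b) (a' , b')) ((a ≟A a') ×-dec (b ≟B b'))
                                (λ e → cong proj₁ e , cong proj₂ e) (λ (e₁ , e₂) → cong₂ _,_ e₁ e₂))
                             (𝟙-× (a ≟A a') (b ≟B b'))
    once : ∀ t → ∑ (λ s → 𝟙 (≡-dec _≟A_ _≟B_ t s)) pairs ≡ 1
    once (a , b) = begin
      ∑ (λ s → 𝟙 (≡-dec _≟A_ _≟B_ (a , b) s)) pairs
        ≡⟨ trans (∑-concatMap _ _ as) (∑-cong as (λ a' → ∑-map _ (a' ,_) bs)) ⟩
      ∑ (λ a' → ∑ (λ b' → 𝟙 (≡-dec _≟A_ _≟B_ (a , b) (a' , b'))) bs) as
        ≡⟨ ∑-cong as (λ a' → ∑-cong bs (λ b' → 𝟙-pair a a' b b')) ⟩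
      ∑ (λ a' → ∑ (λ b' → 𝟙 (a ≟A a') * 𝟙 (b ≟B b')) bs) as
        ≡⟨ ∑-cong as (λ a' → trans (∑-*ˡ (𝟙 (a ≟A a')) _ bs) (trans (cong (𝟙 (a ≟A a') *_) (onceB b)) (*-identityʳ _))) ⟩
      ∑ (λ a' → 𝟙 (a ≟A a')) as
        ≡⟨ onceA a ⟩
      1 ∎

module NatEstimates where

  open import Data.Nat using (ℕ; zero; suc; _+_; _*_; _^_; _≤_; _∸_; ∣_-_∣)
  open import Data.Nat.Properties
  open import Data.Nat.Tactic.RingSolver using (solve; solve-∀)
  open import Data.List using (List; _∷_; [])
  open import Relation.Binary.PropositionalEquality
  open FiniteSums

  ∣-∣-split : ∀ a n → ∣ a - n ∣ ≡ (a ∸ n) + (n ∸ a)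
  ∣-∣-split zero zero = refl
  ∣-∣-split zero (suc n) = refl
  ∣-∣-split (suc a) zero = sym (+-identityʳ (suc a))
  ∣-∣-split (suc a) (suc n) = ∣-∣-split a n

  -- Both sides are max(a, n).
  max-symmetric : ∀ a n → a + (n ∸ a) ≡ n + (a ∸ n)
  max-symmetric zero zero = refl
  max-symmetric zero (suc n) = sym (+-identityʳ (suc n))
  max-symmetric (suc a) zero = +-identityʳ (suc a)
  max-symmetric (suc a) (suc n) = cong suc (max-symmetric a n)

  ∑∣-∣≡2∑∸ : ∀ {A : Set} (xs : List A) (f : A → ℕ) (n : ℕ) → ∑ f xs ≡ ∑ (λ _ → n) xs →
    ∑ (λ x → ∣ f x - n ∣) xs ≡ 2 * ∑ (λ x → f x ∸ n) xs
  ∑∣-∣≡2∑∸ xs f n same-total = begin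
    ∑ (λ x → ∣ f x - n ∣) xs                 ≡⟨ ∑-cong xs (λ x → ∣-∣-split (f x) n) ⟩
    ∑ (λ x → (f x ∸ n) + (n ∸ f x)) xs       ≡⟨ ∑-+ _ _ xs ⟩
    excess + deficit                         ≡⟨ cong (excess +_) deficit≡excess ⟩
    excess + excess                          ≡⟨ cong (excess +_) (sym (+-identityʳ excess)) ⟩
    2 * excess                               ∎
    where
    open ≡-Reasoning
    excess = ∑ (λ x → f x ∸ n) xs
    deficit = ∑ (λ x → n ∸ f x) xs
    deficit≡excess : deficit ≡ excess
    deficit≡excess = +-cancelˡ-≡ (∑ f xs) deficit excess (begin
      ∑ f xs + deficit                       ≡⟨ sym (∑-+ _ _ xs) ⟩
      ∑ (λ x → f x + (n ∸ f x)) xs           ≡⟨ ∑-cong xs (λ x → max-symmetric (f x) n) ⟩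
      ∑ (λ x → n + (f x ∸ n)) xs             ≡⟨ ∑-+ _ _ xs ⟩
      ∑ (λ _ → n) xs + excess                ≡⟨ cong (_+ excess) (sym same-total) ⟩
      ∑ f xs + excess                        ∎)

  -- Estimates for q ≥ 2 and a quantity S with q³ ≤ S + q² (S will be |SL(2,q)|).
  module Estimates (q S : ℕ) (2≤q : 2 ≤ q) (q³≤S+q² : q * (q * q) ≤ S + q * q) where
    open ≤-Reasoning

    2q²≤q³ : 2 * (q * q) ≤ q * (q * q)
    2q²≤q³ = *-monoˡ-≤ (q * q) 2≤q

    q²≤S : q * q ≤ S
    q²≤S = +-cancelʳ-≤ (q * q) (q * q) S (begin
      q * q + q * q          ≡⟨ cong (q * q +_) (sym (+-identityʳ (q * q))) ⟩
      2 * (q * q)            ≤⟨ 2q²≤q³ ⟩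
      q * (q * q)            ≤⟨ q³≤S+q² ⟩
      S + q * q              ∎)

    q³≤2S : q * (q * q) ≤ 2 * S
    q³≤2S = begin
      q * (q * q)            ≤⟨ q³≤S+q² ⟩
      S + q * q              ≤⟨ +-monoʳ-≤ S q²≤S ⟩
      S + S                  ≡⟨ cong (S +_) (sym (+-identityʳ S)) ⟩
      2 * S                  ∎

    n·q≤8S : ∀ n → n ≤ (q * 2) * (q * 2) → n * q ≤ 8 * S
    n·q≤8S n n≤4q² = begin
      n * q                       ≤⟨ *-monoˡ-≤ q n≤4q² ⟩
      (q * 2) * (q * 2) * q       ≡⟨ solve (q ∷ []) ⟩
      4 * (q * (q * q))           ≤⟨ *-monoʳ-≤ 4 q³≤2S ⟩
      4 * (2 * S)                 ≡⟨ sym (*-assoc 4 2 S) ⟩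
      8 * S                       ∎

    excess≤7q² : ∀ n → n ≤ (q + 2) * (q + 2) → q * n ∸ S ≤ 7 * (q * q)
    excess≤7q² n n≤ = m≤n+o⇒m∸n≤o (q * n) S (begin
      q * n                                       ≤⟨ *-monoʳ-≤ q n≤ ⟩
      q * ((q + 2) * (q + 2))                     ≡⟨ solve (q ∷ []) ⟩
      q * (q * q) + 4 * (q * q) + 2 * (2 * q)     ≤⟨ +-mono-≤ (+-monoˡ-≤ (4 * (q * q)) q³≤S+q²) (*-monoʳ-≤ 2 (*-monoˡ-≤ q 2≤q)) ⟩
      S + q * q + 4 * (q * q) + 2 * (q * q)       ≡⟨ solve (q ∷ S ∷ []) ⟩
      S + 7 * (q * q)                             ∎)

    excess≤4q³ : ∀ n → n ≤ (q + 2) * (q * 2) → q * n ∸ S ≤ 4 * (q * (q * q))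
    excess≤4q³ n n≤ = begin
      q * n ∸ S                                   ≤⟨ m∸n≤m (q * n) S ⟩
      q * n                                       ≤⟨ *-monoʳ-≤ q n≤ ⟩
      q * ((q + 2) * (q * 2))                     ≡⟨ solve (q ∷ []) ⟩
      2 * (q * (q * q)) + 2 * (2 * (q * q))       ≤⟨ +-monoʳ-≤ (2 * (q * (q * q))) (*-monoʳ-≤ 2 2q²≤q³) ⟩
      2 * (q * (q * q)) + 2 * (q * (q * q))       ≡⟨ solve (q ∷ []) ⟩
      4 * (q * (q * q))                           ∎

  -- The bound T ≤ 60 S rewritten in the shape T^b q^a ≤ (2 q S C)^b with a = b = 1, C = 30.
  scaled-form : ∀ T q S → T ≤ 60 * S → T ^ 1 * q ^ 1 ≤ (2 * q * S * 30) ^ 1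
  scaled-form T q S T≤60S = subst₂ _≤_ (lhs T q) (rhs q S) (*-monoˡ-≤ q T≤60S)
    where
    lhs : ∀ T q → T * q ≡ T ^ 1 * q ^ 1
    lhs T q = sym (cong₂ _*_ (*-identityʳ T) (*-identityʳ q))
    rhs : ∀ q S → 60 * S * q ≡ 2 * q * S * 30 * 1
    rhs = solve-∀

-- A ring solver for F with integer coefficients: the standard library's
-- normalising solver, instantiated with formal differences of naturals as
-- coefficients.
module IntegerSolver (F : FiniteField) where

  open FiniteField F using (_+_; _*_; -_; 0#; 1#; isCommutativeRing) renaming (Carrier to A)
  open import Relation.Binary.PropositionalEquality

  open import Data.Nat as ℕ using (ℕ; zero; suc)
  open import Data.Bool using (Bool; T)
  open import Data.Product using (_×_; _,_)
  open import Data.Maybe using (nothing)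
  open import Data.Vec using (Vec)
  open import Algebra.Bundles using (CommutativeRing; RawRing)
  open import Tactic.RingSolver.Core.AlmostCommutativeRing using (AlmostCommutativeRing; fromCommutativeRing)
  open import Tactic.RingSolver.Core.Polynomial.Parameters using (Homomorphism)
  open import Tactic.RingSolver.Core.Expression using (Expr; Κ; Ι; _⊕_; _⊗_; ⊝_; _⊛_; module Eval)

  private
    R : CommutativeRing _ _
    R = record { isCommutativeRing = isCommutativeRing }

  open CommutativeRing R using (+-assoc; +-comm; +-identityˡ; -‿inverseʳ; *-identityˡ; distribˡ; distribʳ; zeroˡ; ring)
  open import Algebra.Properties.Ring ring using (-‿distribˡ-*; -‿distribʳ-*; -‿involutive; -0#≈0#; -‿+-comm)
  open ≡-Reasoning

  -- Integer coefficients are represented as formal differences (a , b) = a − b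
  -- of naturals: a coefficient ring whose zero test is decidable, which is
  -- what the normalising ring solver needs.
  ℤ′ : Set
  ℤ′ = ℕ × ℕ

  fromℕ : ℕ → A
  fromℕ zero = 0#
  fromℕ (suc zero) = 1#
  fromℕ (suc (suc n)) = 1# + fromℕ (suc n)

  -- The image of a formal difference; definitionally it cancels common
  -- successors, so that ⟦ (n , n) ⟧ᶻ reduces to 0#.
  ⟦_⟧ᶻ : ℤ′ → A
  ⟦ a , zero ⟧ᶻ = fromℕ a
  ⟦ zero , suc b ⟧ᶻ = - fromℕ (suc b)
  ⟦ suc a , suc b ⟧ᶻ = ⟦ a , b ⟧ᶻ

  infixl 6 _+ᶻ_
  infixl 7 _*ᶻ_
  _+ᶻ_ _*ᶻ_ : ℤ′ → ℤ′ → ℤ′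
  (a , b) +ᶻ (c , d) = (a ℕ.+ c , b ℕ.+ d)
  (a , b) *ᶻ (c , d) = (a ℕ.* c ℕ.+ b ℕ.* d , a ℕ.* d ℕ.+ b ℕ.* c)

  -ᶻ_ : ℤ′ → ℤ′
  -ᶻ (a , b) = (b , a)

  private
    interchange : ∀ a b c d → (a + b) + (c + d) ≡ (a + c) + (b + d)
    interchange a b c d = begin
      (a + b) + (c + d) ≡⟨ +-assoc a b (c + d) ⟩
      a + (b + (c + d)) ≡⟨ cong (a +_) (sym (+-assoc b c d)) ⟩
      a + ((b + c) + d) ≡⟨ cong (λ z → a + (z + d)) (+-comm b c) ⟩
      a + ((c + b) + d) ≡⟨ cong (a +_) (+-assoc c b d) ⟩
      a + (c + (b + d)) ≡⟨ sym (+-assoc a c (b + d)) ⟩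
      (a + c) + (b + d) ∎

    -‿distrib-+ : ∀ x y → - (x + y) ≡ - x + - y
    -‿distrib-+ x y = sym (-‿+-comm x y)

    fromℕ-suc : ∀ n → fromℕ (suc n) ≡ 1# + fromℕ n
    fromℕ-suc zero = sym (trans (+-comm 1# 0#) (+-identityˡ 1#))
    fromℕ-suc (suc n) = refl

    fromℕ-+ : ∀ m n → fromℕ (m ℕ.+ n) ≡ fromℕ m + fromℕ n
    fromℕ-+ zero n = sym (+-identityˡ _)
    fromℕ-+ (suc m) n = begin
      fromℕ (suc (m ℕ.+ n))      ≡⟨ fromℕ-suc (m ℕ.+ n) ⟩
      1# + fromℕ (m ℕ.+ n)       ≡⟨ cong (1# +_) (fromℕ-+ m n) ⟩
      1# + (fromℕ m + fromℕ n)   ≡⟨ sym (+-assoc _ _ _) ⟩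
      (1# + fromℕ m) + fromℕ n   ≡⟨ cong (_+ fromℕ n) (sym (fromℕ-suc m)) ⟩
      fromℕ (suc m) + fromℕ n    ∎

    fromℕ-* : ∀ m n → fromℕ (m ℕ.* n) ≡ fromℕ m * fromℕ n
    fromℕ-* zero n = sym (zeroˡ _)
    fromℕ-* (suc m) n = begin
      fromℕ (n ℕ.+ m ℕ.* n)                  ≡⟨ fromℕ-+ n (m ℕ.* n) ⟩
      fromℕ n + fromℕ (m ℕ.* n)              ≡⟨ cong (fromℕ n +_) (fromℕ-* m n) ⟩
      fromℕ n + fromℕ m * fromℕ n            ≡⟨ cong (_+ fromℕ m * fromℕ n) (sym (*-identityˡ _)) ⟩
      1# * fromℕ n + fromℕ m * fromℕ n       ≡⟨ sym (distribʳ _ _ _) ⟩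
      (1# + fromℕ m) * fromℕ n               ≡⟨ cong (_* fromℕ n) (sym (fromℕ-suc m)) ⟩
      fromℕ (suc m) * fromℕ n                ∎

    ⟦⟧ᶻ-difference : ∀ a b → ⟦ a , b ⟧ᶻ ≡ fromℕ a + - fromℕ b
    ⟦⟧ᶻ-difference a zero = sym (trans (cong (fromℕ a +_) -0#≈0#) (trans (+-comm _ 0#) (+-identityˡ _)))
    ⟦⟧ᶻ-difference zero (suc b) = sym (+-identityˡ _)
    ⟦⟧ᶻ-difference (suc a) (suc b) = begin
      ⟦ a , b ⟧ᶻ                                   ≡⟨ ⟦⟧ᶻ-difference a b ⟩
      fromℕ a + - fromℕ b                          ≡⟨ sym cancel-1 ⟩
      (1# + fromℕ a) + - (1# + fromℕ b)            ≡⟨ sym (cong₂ (λ u w → u + - w) (fromℕ-suc a) (fromℕ-suc b)) ⟩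
      fromℕ (suc a) + - fromℕ (suc b)              ∎
      where
      cancel-1 : (1# + fromℕ a) + - (1# + fromℕ b) ≡ fromℕ a + - fromℕ b
      cancel-1 = begin
        (1# + fromℕ a) + - (1# + fromℕ b)          ≡⟨ cong ((1# + fromℕ a) +_) (-‿distrib-+ 1# (fromℕ b)) ⟩
        (1# + fromℕ a) + (- 1# + - fromℕ b)        ≡⟨ interchange 1# (fromℕ a) (- 1#) (- fromℕ b) ⟩
        (1# + - 1#) + (fromℕ a + - fromℕ b)        ≡⟨ cong (_+ (fromℕ a + - fromℕ b)) (-‿inverseʳ 1#) ⟩
        0# + (fromℕ a + - fromℕ b)                 ≡⟨ +-identityˡ _ ⟩
        fromℕ a + - fromℕ b                        ∎

    +ᶻ-homo : ∀ p q → ⟦ p +ᶻ q ⟧ᶻ ≡ ⟦ p ⟧ᶻ + ⟦ q ⟧ᶻ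
    +ᶻ-homo (a , b) (c , d) = begin
      ⟦ a ℕ.+ c , b ℕ.+ d ⟧ᶻ                        ≡⟨ ⟦⟧ᶻ-difference (a ℕ.+ c) (b ℕ.+ d) ⟩
      fromℕ (a ℕ.+ c) + - fromℕ (b ℕ.+ d)           ≡⟨ cong₂ (λ u w → u + - w) (fromℕ-+ a c) (fromℕ-+ b d) ⟩
      (A′ + C′) + - (B′ + D′)                       ≡⟨ cong ((A′ + C′) +_) (-‿distrib-+ B′ D′) ⟩
      (A′ + C′) + (- B′ + - D′)                     ≡⟨ interchange _ _ _ _ ⟩
      (A′ + - B′) + (C′ + - D′)                     ≡⟨ sym (cong₂ _+_ (⟦⟧ᶻ-difference a b) (⟦⟧ᶻ-difference c d)) ⟩
      ⟦ a , b ⟧ᶻ + ⟦ c , d ⟧ᶻ                       ∎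
      where A′ = fromℕ a ; B′ = fromℕ b ; C′ = fromℕ c ; D′ = fromℕ d

    *ᶻ-homo : ∀ p q → ⟦ p *ᶻ q ⟧ᶻ ≡ ⟦ p ⟧ᶻ * ⟦ q ⟧ᶻ
    *ᶻ-homo (a , b) (c , d) = begin
      ⟦ a ℕ.* c ℕ.+ b ℕ.* d , a ℕ.* d ℕ.+ b ℕ.* c ⟧ᶻ
        ≡⟨ ⟦⟧ᶻ-difference (a ℕ.* c ℕ.+ b ℕ.* d) (a ℕ.* d ℕ.+ b ℕ.* c) ⟩
      fromℕ (a ℕ.* c ℕ.+ b ℕ.* d) + - fromℕ (a ℕ.* d ℕ.+ b ℕ.* c)
        ≡⟨ cong₂ (λ u w → u + - w) (image-+* a c b d) (image-+* a d b c) ⟩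
      (A′ * C′ + B′ * D′) + - (A′ * D′ + B′ * C′)
        ≡⟨ cong ((A′ * C′ + B′ * D′) +_) (-‿distrib-+ _ _) ⟩
      (A′ * C′ + B′ * D′) + (- (A′ * D′) + - (B′ * C′))
        ≡⟨ interchange _ _ _ _ ⟩
      (A′ * C′ + - (A′ * D′)) + (B′ * D′ + - (B′ * C′))
        ≡⟨ cong ((A′ * C′ + - (A′ * D′)) +_) (+-comm _ _) ⟩
      (A′ * C′ + - (A′ * D′)) + (- (B′ * C′) + B′ * D′)
        ≡⟨ cong₂ _+_ (cong (A′ * C′ +_) (-‿distribʳ-* A′ D′)) (cong₂ _+_ (-‿distribˡ-* B′ C′) negneg) ⟩
      (A′ * C′ + A′ * - D′) + (- B′ * C′ + - B′ * - D′)
        ≡⟨ cong₂ _+_ (sym (distribˡ A′ C′ (- D′))) (sym (distribˡ (- B′) C′ (- D′))) ⟩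
      A′ * (C′ + - D′) + - B′ * (C′ + - D′)
        ≡⟨ sym (distribʳ _ _ _) ⟩
      (A′ + - B′) * (C′ + - D′)
        ≡⟨ sym (cong₂ _*_ (⟦⟧ᶻ-difference a b) (⟦⟧ᶻ-difference c d)) ⟩
      ⟦ a , b ⟧ᶻ * ⟦ c , d ⟧ᶻ ∎
      where
      A′ = fromℕ a ; B′ = fromℕ b ; C′ = fromℕ c ; D′ = fromℕ d
      image-+* : ∀ m n k l → fromℕ (m ℕ.* n ℕ.+ k ℕ.* l) ≡ fromℕ m * fromℕ n + fromℕ k * fromℕ l
      image-+* m n k l = trans (fromℕ-+ (m ℕ.* n) (k ℕ.* l)) (cong₂ _+_ (fromℕ-* m n) (fromℕ-* k l))
      negneg : B′ * D′ ≡ - B′ * - D′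
      negneg = trans (sym (-‿involutive (B′ * D′))) (trans (cong -_ (-‿distribʳ-* B′ D′)) (-‿distribˡ-* B′ (- D′)))

    -ᶻ-homo : ∀ p → ⟦ -ᶻ p ⟧ᶻ ≡ - ⟦ p ⟧ᶻ
    -ᶻ-homo (a , b) = begin
      ⟦ b , a ⟧ᶻ                       ≡⟨ ⟦⟧ᶻ-difference b a ⟩
      fromℕ b + - fromℕ a              ≡⟨ cong (_+ - fromℕ a) (sym (-‿involutive _)) ⟩
      - - fromℕ b + - fromℕ a          ≡⟨ +-comm _ _ ⟩
      - fromℕ a + - - fromℕ b          ≡⟨ -‿+-comm _ _ ⟩
      - (fromℕ a + - fromℕ b)          ≡⟨ cong -_ (sym (⟦⟧ᶻ-difference a b)) ⟩
      - ⟦ a , b ⟧ᶻ                     ∎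

    isZeroᶻ : ℤ′ → Bool
    isZeroᶻ (a , b) = a ℕ.≡ᵇ b

    isZeroᶻ-sound : ∀ p → T (isZeroᶻ p) → 0# ≡ ⟦ p ⟧ᶻ
    isZeroᶻ-sound (zero , zero) _ = refl
    isZeroᶻ-sound (suc a , suc b) t = isZeroᶻ-sound (a , b) t

    ℤ′-rawRing : RawRing _ _
    ℤ′-rawRing = record
      { Carrier = ℤ′ ; _≈_ = _≡_ ; _+_ = _+ᶻ_ ; _*_ = _*ᶻ_ ; -_ = -ᶻ_ ; 0# = (0 , 0) ; 1# = (1 , 0) }

    almostRing : AlmostCommutativeRing _ _
    almostRing = fromCommutativeRing R (λ _ → nothing)

    homomorphism : Homomorphism _ _ _ _
    homomorphism = record
      { from = record { rawRing = ℤ′-rawRing ; isZero = isZeroᶻ }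
      ; to = almostRing
      ; morphism = record
          { ⟦_⟧ = ⟦_⟧ᶻ ; +-homo = +ᶻ-homo ; *-homo = *ᶻ-homo ; -‿homo = -ᶻ-homo ; 0-homo = refl ; 1-homo = refl }
      ; Zero-C⟶Zero-R = isZeroᶻ-sound
      }

    module Reflect where
      open Eval (AlmostCommutativeRing.rawRing almostRing) ⟦_⟧ᶻ public
      open import Tactic.RingSolver.Core.Polynomial.Base (Homomorphism.from homomorphism)
      open import Tactic.RingSolver.Core.Polynomial.Semantics homomorphism renaming (⟦_⟧ to ⟦_⟧ₚ)
      open import Tactic.RingSolver.Core.Polynomial.Homomorphism homomorphism

      normalise : ∀ {n} → Expr ℤ′ n → Poly n
      normalise (Κ x)   = κ x
      normalise (Ι x)   = ι x
      normalise (x ⊕ y) = normalise x ⊞ normalise y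
      normalise (x ⊗ y) = normalise x ⊠ normalise y
      normalise (⊝ x)   = ⊟ normalise x
      normalise (x ⊛ i) = normalise x ⊡ i

      ⟦_⇓⟧ : ∀ {n} → Expr ℤ′ n → Vec A n → A
      ⟦ e ⇓⟧ = ⟦ normalise e ⟧ₚ

      correct : ∀ {n} (e : Expr ℤ′ n) ρ → ⟦ e ⇓⟧ ρ ≡ ⟦ e ⟧ ρ
      correct (Κ x)   ρ = κ-hom x ρ
      correct (Ι x)   ρ = ι-hom x ρ
      correct (x ⊕ y) ρ = trans (⊞-hom (normalise x) (normalise y) ρ) (cong₂ _+_ (correct x ρ) (correct y ρ))
      correct (x ⊗ y) ρ = trans (⊠-hom (normalise x) (normalise y) ρ) (cong₂ _*_ (correct x ρ) (correct y ρ))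
      correct (⊝ x)   ρ = trans (⊟-hom (normalise x) ρ) (cong -_ (correct x ρ))
      correct (x ⊛ i) ρ = trans (⊡-hom (normalise x) i ρ) (cong (λ z → AlmostCommutativeRing._^_ almostRing z i) (correct x ρ))

      open import Relation.Binary.Reflection (setoid A) Ι ⟦_⟧ ⟦_⇓⟧ correct public using (_⊜_; solve)

  -- The ring solver: `solve n (λ x₁ … xₙ → lhs ⊜ rhs) refl` proves
  -- ∀ x₁ … xₙ → lhs ≡ rhs for a polynomial identity with integer
  -- coefficients, with lhs and rhs written using _⊕_, _⊗_, ⊝_, #0 and #1
  -- in place of _+_, _*_, -_, 0# and 1#.
  open Reflect public using (solve; _⊜_)
  open import Tactic.RingSolver.Core.Expression public using (Expr; _⊕_; _⊗_; ⊝_)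

  #0 #1 : ∀ {n} → Expr ℤ′ n
  #0 = Κ (0 , 0)
  #1 = Κ (1 , 0)

  -- Expressions in n variables form a raw ring, so polynomial functions defined
  -- over an arbitrary raw ring can be instantiated both in F and as solver input.
  syntax-rawRing : ℕ → RawRing _ _
  syntax-rawRing n = record
    { Carrier = Expr ℤ′ n ; _≈_ = _≡_ ; _+_ = _⊕_ ; _*_ = _⊗_ ; -_ = ⊝_ ; 0# = #0 ; 1# = #1 }

  field-rawRing : RawRing _ _
  field-rawRing = CommutativeRing.rawRing R

-- The polynomials of the argument, defined over an arbitrary raw ring so that
-- they can be used both in F and, symbolically, as input to the ring solver.
module Polynomials {c ℓ} (R : RawRing c ℓ) where

  open RawRing R

  two : Carrier
  two = 1# + 1#

  conic : Carrier → Carrier → Carrier → Carrier → Carrier → Carrier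
  conic v w y m₁ m₂ = m₁ * m₁ + w * m₁ * m₂ + - (m₂ * m₂) + - (v * m₁) + y * m₂ + - 1#

  -- Its discriminant; the conic is degenerate only where this vanishes.
  discriminant : Carrier → Carrier → Carrier → Carrier
  discriminant v w y = y * y + v * w * y + - (v * v) + - (w * w) + - (1# + 1# + 1# + 1#)

  -- On the line (p₁ + s t, p₂ + t) through a point p of the plane, the conic is
  --   K(p) + t (chord-linear + t · chord-quadratic).
  chord-linear : Carrier → Carrier → Carrier → Carrier → Carrier → Carrier → Carrier
  chord-linear v w y p₁ p₂ s = two * p₁ * s + w * p₁ + w * s * p₂ + - (two * p₂) + - (v * s) + y

  chord-quadratic : Carrier → Carrier → Carrier
  chord-quadratic w s = s * s + w * s + - 1#

  -- Multipliers exhibiting s · discriminant in the ideal generated by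
  -- chord-quadratic, chord-linear and K(p).
  multiplier-quadratic multiplier-linear : Carrier → Carrier → Carrier → Carrier → Carrier → Carrier → Carrier
  multiplier-quadratic v w y p₁ p₂ s =
    s + - w + two * p₁ * p₂ + - (p₁ * y) + - (two * p₂ * v) + v * y
    + s * p₁ * p₁ + s * p₂ * p₂ + - (s * p₂ * y) + p₂ * p₂ * w
  multiplier-linear v w y p₁ p₂ s = - p₁ + v + - (two * s * p₂) + s * y + - (p₂ * w) + - (s * s * p₁)

  multiplier-conic : Carrier → Carrier → Carrier
  multiplier-conic w s = (1# + 1# + 1#) * s + w + s * s * s

-- 2×2 matrices over an arbitrary raw ring, with the same formulas as the
-- matrices of Defs; instantiated symbolically they let the ring solver
-- verify matrix identities entry by entry.
module MatrixPolynomials {r ℓ} (R : RawRing r ℓ) where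

  open RawRing R

  record Matrix : Set r where
    constructor matrix
    field a b c d : Carrier

  infixl 7 _⊙_
  _⊙_ : Matrix → Matrix → Matrix
  matrix a b c d ⊙ matrix a' b' c' d' =
    matrix (a * a' + b * c') (a * b' + b * d') (c * a' + d * c') (c * b' + d * d')

  adjugate : Matrix → Matrix
  adjugate (matrix a b c d) = matrix d (- b) (- c) a

  determinant : Matrix → Carrier
  determinant (matrix a b c d) = a * d + - (b * c)

module FieldFacts (F : FiniteField) where

  open FiniteField F
  open import Data.Nat as ℕ using (ℕ; z≤n; s≤s; _<?_) renaming (_+_ to _+ℕ_; _*_ to _*ℕ_; _≤_ to _≤ℕ_)
  import Data.Nat.Properties as ℕ
  open import Data.Nat.Divisibility using (_∣_; divides; ∣m+n∣m⇒∣n; ∣⇒≤)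
  open import Data.Fin using (toℕ)
  open import Data.Fin.Properties using (toℕ-injective)
  open import Data.List using (length; allFin)
  open import Data.List.Properties using (length-map; length-tabulate)
  open import Data.Product using (proj₁; proj₂)
  open import Data.Sum using (_⊎_; inj₁; inj₂)
  open import Data.Empty using (⊥-elim)
  open import Relation.Nullary using (¬_; yes; no; ¬?)
  open import Relation.Binary.PropositionalEquality
  open import Function.Bundles using (Inverse)
  open import Algebra.Bundles using (CommutativeRing)
  open FiniteSums
  open Enumerations
  open IntegerSolver F
  open ≡-Reasoning

  ring : CommutativeRing _ _
  ring = record { isCommutativeRing = isCommutativeRing }
  open CommutativeRing ring using (+-identityˡ; -‿inverseʳ; *-assoc; *-comm; *-identityˡ; zeroʳ)

  elements : Enumeration Carrier
  elements = ↔-enumeration enum _≟_ (Fin-enumeration size)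

  module Elements = EnumerationProperties elements

  ∑F : (Carrier → ℕ) → ℕ
  ∑F f = ∑ f (elems F)

  ∑F-const : ∀ c → ∑F (λ _ → c) ≡ size *ℕ c
  ∑F-const c = trans (∑-const c (elems F)) (cong (_*ℕ c) length-elems)
    where
    length-elems : length (elems F) ≡ size
    length-elems = trans (length-map (Inverse.from enum) (allFin size)) (length-tabulate (λ i → i))

  size-as-count : ∑F (λ _ → 1) ≡ size
  size-as-count = trans (∑F-const 1) (ℕ.*-identityʳ size)

  two≤size : 2 ≤ℕ size
  two≤size = subst (2 ≤ℕ_) size-as-count (ℕ.≤-trans two-indicators (∑-mono (elems F) at-most-one))
    where
    two-indicators : 2 ≤ℕ ∑F (λ s → 𝟙 (0# ≟ s) +ℕ 𝟙 (1# ≟ s))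
    two-indicators = ℕ.≤-reflexive (sym (trans (∑-+ _ _ (elems F))
                       (cong₂ _+ℕ_ (Enumeration.once elements 0#) (Enumeration.once elements 1#))))
    at-most-one : ∀ s → 𝟙 (0# ≟ s) +ℕ 𝟙 (1# ≟ s) ≤ℕ 1
    at-most-one s with 0# ≟ s | 1# ≟ s
    ... | yes e₀ | yes e₁ = ⊥-elim (0≢1 (trans e₀ (sym e₁)))
    ... | yes _ | no _ = s≤s z≤n
    ... | no _ | yes _ = s≤s z≤n
    ... | no _ | no _ = z≤n

  -- The inverse, extended by 0⁻¹ = 0.
  _⁻¹ : Carrier → Carrier
  x ⁻¹ with x ≟ 0#
  ... | yes _ = 0#
  ... | no x≢0 = proj₁ (inverse x x≢0)

  ⁻¹-inverse : ∀ x → x ≢ 0# → x * x ⁻¹ ≡ 1#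
  ⁻¹-inverse x x≢0 with x ≟ 0#
  ... | yes x≡0 = ⊥-elim (x≢0 x≡0)
  ... | no x≢0 = proj₂ (inverse x x≢0)

  zero-product : ∀ x y → x * y ≡ 0# → x ≡ 0# ⊎ y ≡ 0#
  zero-product x y xy≡0 with x ≟ 0#
  ... | yes x≡0 = inj₁ x≡0
  ... | no x≢0 = inj₂ (begin
    y                  ≡⟨ sym (*-identityˡ y) ⟩
    1# * y             ≡⟨ cong (_* y) (sym (trans (*-comm (x ⁻¹) x) (⁻¹-inverse x x≢0))) ⟩
    (x ⁻¹ * x) * y     ≡⟨ *-assoc (x ⁻¹) x y ⟩
    x ⁻¹ * (x * y)     ≡⟨ cong (x ⁻¹ *_) xy≡0 ⟩
    x ⁻¹ * 0#          ≡⟨ zeroʳ _ ⟩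
    0#                 ∎)

  square-zero : ∀ x → x * x ≡ 0# → x ≡ 0#
  square-zero x e with zero-product x x e
  ... | inj₁ p = p
  ... | inj₂ p = p

  difference-zero : ∀ x y → x + - y ≡ 0# → x ≡ y
  difference-zero x y e = begin
    x                 ≡⟨ solve 2 (λ x y → x ⊜ (x ⊕ ⊝ y) ⊕ y) refl x y ⟩
    (x + - y) + y     ≡⟨ cong (_+ y) e ⟩
    0# + y            ≡⟨ +-identityˡ y ⟩
    y                 ∎

  sum-zero : ∀ x y → x + y ≡ 0# → - y ≡ x
  sum-zero x y e = sym (difference-zero x (- y) (trans (cong (x +_) (solve 1 (λ y → ⊝ ⊝ y ⊜ y) refl y)) e))

  -- A monic quadratic z² + bz + c has at most two roots: if r is one, the
  -- other roots z satisfy (z − r)(z + r + b) = 0.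
  quadratic-roots : ∀ b c → Elements.count (λ z → (z * z + b * z + c) ≟ 0#) ≤ℕ 2
  quadratic-roots b c = count-from-witness (λ z → (z * z + b * z + c) ≟ 0#) (elems F) 2 λ r root-r →
    Elements.count≤2 (λ z → (z * z + b * z + c) ≟ 0#) r (- (r + b)) λ z root-z →
      case zero-product _ _ (factor z r root-z root-r) of λ where
        (inj₁ p) → inj₁ (sym (difference-zero z r p))
        (inj₂ p) → inj₂ (sum-zero z (r + b) p)
    where
    open import Function using (case_of_)
    factor : ∀ z r → z * z + b * z + c ≡ 0# → r * r + b * r + c ≡ 0# → (z + - r) * (z + (r + b)) ≡ 0#
    factor z r ez er = begin
      (z + - r) * (z + (r + b))
        ≡⟨ solve 4 (λ z r b c → (z ⊕ ⊝ r) ⊗ (z ⊕ (r ⊕ b)) ⊜ (z ⊗ z ⊕ b ⊗ z ⊕ c) ⊕ ⊝ (r ⊗ r ⊕ b ⊗ r ⊕ c)) refl z r b c ⟩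
      (z * z + b * z + c) + - (r * r + b * r + c)         ≡⟨ cong₂ (λ u v → u + - v) ez er ⟩
      0# + - 0#                                          ≡⟨ solve 0 (#0 ⊕ ⊝ #0 ⊜ #0) refl ⟩
      0#                                                 ∎

  -- If 1 + 1 ≠ 0 then q is odd: negation is an involution of F fixing only 0.
  odd-order : 1# + 1# ≢ 0# → ¬ (2 ∣ size)
  odd-order two≢0 2∣size = 2∤odd (subst (2 ∣_) size≡1+2k 2∣size)
    where
    open Inverse enum using (to; inverseʳ)
    ι : Carrier → ℕ
    ι x = toℕ (to x)
    ι-injective : ∀ {x y} → ι x ≡ ι y → x ≡ y
    ι-injective {x} {y} e = trans (sym (inverseʳ {x} refl)) (inverseʳ (toℕ-injective e))
    k : ℕ
    k = Elements.count (λ x → ι x <? ι (- x))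
    fixed-is-zero : ∀ x → - x ≡ x → x ≡ 0#
    fixed-is-zero x e with zero-product (1# + 1#) x (trans (solve 1 (λ x → (#1 ⊕ #1) ⊗ x ⊜ x ⊕ x) refl x)
                                                        (trans (cong (x +_) (sym e)) (-‿inverseʳ x)))
    ... | inj₁ p = ⊥-elim (two≢0 p)
    ... | inj₂ p = p
    fixed-count : Elements.count (λ x → (- x) ≟ x) ≡ 1
    fixed-count = trans (∑-cong (elems F) (λ x → 𝟙-cong ((- x) ≟ x) (0# ≟ x) (λ e → sym (fixed-is-zero x e))
                                               (λ e → trans (cong -_ (sym e)) (trans (solve 0 (⊝ #0 ⊜ #0) refl) e))))
                        (Enumeration.once elements 0#)
    size≡1+2k : size ≡ 1 +ℕ 2 *ℕ k
    size≡1+2k = begin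
      size                                                          ≡⟨ sym size-as-count ⟩
      ∑F (λ _ → 1)                                                  ≡⟨ ∑-cong (elems F) (λ x → sym (𝟙-¬? ((- x) ≟ x))) ⟩
      ∑F (λ x → 𝟙 ((- x) ≟ x) +ℕ 𝟙 (¬? ((- x) ≟ x)))                    ≡⟨ ∑-+ _ _ (elems F) ⟩
      Elements.count (λ x → (- x) ≟ x) +ℕ Elements.count (λ x → ¬? ((- x) ≟ x))
        ≡⟨ cong₂ _+ℕ_ fixed-count (Elements.moved-points-even -_ (λ x → solve 1 (λ x → ⊝ ⊝ x ⊜ x) refl x) ι ι-injective) ⟩
      1 +ℕ 2 *ℕ k                                                   ∎
    2∤odd : ¬ (2 ∣ 1 +ℕ 2 *ℕ k)
    2∤odd d with ∣⇒≤ (∣m+n∣m⇒∣n (subst (2 ∣_) (ℕ.+-comm 1 (2 *ℕ k)) d) (divides k (ℕ.*-comm 2 k)))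
    ... | s≤s ()

module MatrixEnumeration (F : FiniteField) where

  open FiniteField F
  open import Data.Nat as ℕ using (ℕ) renaming (_+_ to _+ℕ_; _*_ to _*ℕ_; _≤_ to _≤ℕ_)
  import Data.Nat.Properties as ℕ
  open import Relation.Nullary using (yes; no)
  open import Relation.Binary.PropositionalEquality
  open import Relation.Binary.Definitions using (DecidableEquality)
  open FiniteSums
  open Enumerations
  open FieldFacts F
  open IntegerSolver F
  open ≡-Reasoning

  mat-cong : ∀ {a b c d a' b' c' d' : Carrier} → a ≡ a' → b ≡ b' → c ≡ c' → d ≡ d' → mat {F} a b c d ≡ mat a' b' c' d'
  mat-cong refl refl refl refl = refl

  _≟M_ : DecidableEquality (Mat2 F)
  mat a b c d ≟M mat a' b' c' d' with a ≟ a' | b ≟ b' | c ≟ c' | d ≟ d'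
  ... | yes refl | yes refl | yes refl | yes refl = yes refl
  ... | no ne | _ | _ | _ = no (λ e → ne (cong Mat2.a e))
  ... | yes _ | no ne | _ | _ = no (λ e → ne (cong Mat2.b e))
  ... | yes _ | yes _ | no ne | _ = no (λ e → ne (cong Mat2.c e))
  ... | yes _ | yes _ | yes _ | no ne = no (λ e → ne (cong Mat2.d e))

  ∑M : (Mat2 F → ℕ) → ℕ
  ∑M f = ∑ f (allMat F)

  ∑M-entries : ∀ f → ∑M f ≡ ∑F (λ a → ∑F (λ b → ∑F (λ c → ∑F (λ d → f (mat a b c d)))))
  ∑M-entries f =
    trans (∑-concatMap f _ (elems F)) (∑-cong (elems F) (λ a →
    trans (∑-concatMap f _ (elems F)) (∑-cong (elems F) (λ b →
    trans (∑-concatMap f _ (elems F)) (∑-cong (elems F) (λ c → ∑-map f _ (elems F)))))))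

  matrices : Enumeration (Mat2 F)
  matrices = record { list = allMat F ; _≟_ = _≟M_ ; once = once }
    where
    δ : Carrier → Carrier → ℕ
    δ x y = 𝟙 (x ≟ y)
    𝟙-entries : ∀ a b c d a' b' c' d' → 𝟙 (mat a b c d ≟M mat a' b' c' d') ≡ δ a a' *ℕ (δ b b' *ℕ (δ c c' *ℕ δ d d'))
    𝟙-entries a b c d a' b' c' d' with a ≟ a' | b ≟ b' | c ≟ c' | d ≟ d'
    ... | yes refl | yes refl | yes refl | yes refl = refl
    ... | no _ | _ | _ | _ = refl
    ... | yes refl | no _ | _ | _ = refl
    ... | yes refl | yes refl | no _ | _ = refl
    ... | yes refl | yes refl | yes refl | no _ = refl
    once : ∀ t → ∑M (λ s → 𝟙 (t ≟M s)) ≡ 1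
    once (mat a b c d) = begin
      ∑M (λ s → 𝟙 (mat a b c d ≟M s))
        ≡⟨ ∑M-entries _ ⟩
      ∑F (λ a' → ∑F (λ b' → ∑F (λ c' → ∑F (λ d' → 𝟙 (mat a b c d ≟M mat a' b' c' d')))))
        ≡⟨ ∑-cong (elems F) (λ a' → ∑-cong (elems F) (λ b' → ∑-cong (elems F) (λ c' → ∑-cong (elems F) (λ d' → 𝟙-entries a b c d a' b' c' d')))) ⟩
      ∑F (λ a' → ∑F (λ b' → ∑F (λ c' → ∑F (λ d' → δ a a' *ℕ (δ b b' *ℕ (δ c c' *ℕ δ d d'))))))
        ≡⟨ ∑-cong (elems F) (λ a' → trans (∑-cong (elems F) (λ b' →
             trans (∑-cong (elems F) (λ c' → ∑-*ˡ (δ a a') _ (elems F))) (∑-*ˡ (δ a a') _ (elems F))))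
             (∑-*ˡ (δ a a') _ (elems F))) ⟩
      ∑F (λ a' → δ a a' *ℕ ∑F (λ b' → ∑F (λ c' → ∑F (λ d' → δ b b' *ℕ (δ c c' *ℕ δ d d')))))
        ≡⟨ Elements.∑-delta a _ ⟩
      ∑F (λ b' → ∑F (λ c' → ∑F (λ d' → δ b b' *ℕ (δ c c' *ℕ δ d d'))))
        ≡⟨ ∑-cong (elems F) (λ b' → trans (∑-cong (elems F) (λ c' → ∑-*ˡ (δ b b') _ (elems F))) (∑-*ˡ (δ b b') _ (elems F))) ⟩
      ∑F (λ b' → δ b b' *ℕ ∑F (λ c' → ∑F (λ d' → δ c c' *ℕ δ d d')))
        ≡⟨ Elements.∑-delta b _ ⟩
      ∑F (λ c' → ∑F (λ d' → δ c c' *ℕ δ d d'))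
        ≡⟨ ∑-cong (elems F) (λ c' → ∑-*ˡ (δ c c') _ (elems F)) ⟩
      ∑F (λ c' → δ c c' *ℕ ∑F (λ d' → δ d d'))
        ≡⟨ Elements.∑-delta c _ ⟩
      ∑F (λ d' → δ d d')
        ≡⟨ Enumeration.once elements d ⟩
      1 ∎

  module Matrices = EnumerationProperties matrices

  |SL2| : ℕ
  |SL2| = Matrices.count (λ u → det F u ≟ 1#)

  orderSL2≡|SL2| : orderSL2 F ≡ |SL2|
  orderSL2≡|SL2| = length-filter (λ u → det F u ≟ 1#) (allMat F)

  -- q³ ≤ |SL(2,q)| + q²: for a ≠ 0 and any b, c, the entry d = (1 + bc)/a
  -- gives a matrix of determinant one.
  |SL2|-lower-bound : size *ℕ (size *ℕ size) ≤ℕ |SL2| +ℕ size *ℕ size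
  |SL2|-lower-bound = subst₂ _≤ℕ_ cube split
    (∑-mono (elems F) (λ a → ∑-mono (elems F) (λ b → ∑-mono (elems F) (λ c → completions a b c))))
    where
    completions : ∀ a b c → 1 ≤ℕ ∑F (λ d → 𝟙 (det F (mat a b c d) ≟ 1#)) +ℕ 𝟙 (0# ≟ a)
    completions a b c with 0# ≟ a
    ... | yes _ = ℕ.m≤n+m 1 _
    ... | no 0≢a = ℕ.≤-trans (ℕ.≤-trans (ℕ.≤-reflexive (sym (Enumeration.once elements d₀)))
                                        (∑-mono (elems F) (λ d → 𝟙-mono (d₀ ≟ d) (det F (mat a b c d) ≟ 1#) has-det-one)))
                             (ℕ.m≤m+n _ 0)
      where
      d₀ : Carrier
      d₀ = (1# + b * c) * a ⁻¹
      has-det-one : ∀ {d} → d₀ ≡ d → det F (mat a b c d) ≡ 1#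
      has-det-one refl = begin
        a * ((1# + b * c) * a ⁻¹) + - (b * c)
          ≡⟨ solve 4 (λ a b c i → a ⊗ ((#1 ⊕ b ⊗ c) ⊗ i) ⊕ ⊝ (b ⊗ c) ⊜ (#1 ⊕ b ⊗ c) ⊗ (a ⊗ i) ⊕ ⊝ (b ⊗ c)) refl a b c (a ⁻¹) ⟩
        (1# + b * c) * (a * a ⁻¹) + - (b * c)   ≡⟨ cong (λ z → (1# + b * c) * z + - (b * c)) (⁻¹-inverse a (λ e → 0≢a (sym e))) ⟩
        (1# + b * c) * 1# + - (b * c)           ≡⟨ solve 2 (λ b c → (#1 ⊕ b ⊗ c) ⊗ #1 ⊕ ⊝ (b ⊗ c) ⊜ #1) refl b c ⟩
        1#                                      ∎
    cube : ∑F (λ a → ∑F (λ b → ∑F (λ c → 1))) ≡ size *ℕ (size *ℕ size)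
    cube = trans (∑-cong (elems F) (λ a → trans (∑-cong (elems F) (λ b → size-as-count)) (∑F-const size)))
                 (∑F-const (size *ℕ size))
    split : ∑F (λ a → ∑F (λ b → ∑F (λ c → ∑F (λ d → 𝟙 (det F (mat a b c d) ≟ 1#)) +ℕ 𝟙 (0# ≟ a))))
            ≡ |SL2| +ℕ size *ℕ size
    split = begin
      ∑F (λ a → ∑F (λ b → ∑F (λ c → ∑F (λ d → 𝟙 (det F (mat a b c d) ≟ 1#)) +ℕ 𝟙 (0# ≟ a))))
        ≡⟨ ∑-cong (elems F) (λ a → trans (∑-cong (elems F) (λ b → ∑-+ _ _ (elems F))) (∑-+ _ _ (elems F))) ⟩
      ∑F (λ a → ∑F (λ b → ∑F (λ c → ∑F (λ d → 𝟙 (det F (mat a b c d) ≟ 1#)))) +ℕ ∑F (λ b → ∑F (λ c → 𝟙 (0# ≟ a))))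
        ≡⟨ ∑-+ _ _ (elems F) ⟩
      ∑F (λ a → ∑F (λ b → ∑F (λ c → ∑F (λ d → 𝟙 (det F (mat a b c d) ≟ 1#))))) +ℕ ∑F (λ a → ∑F (λ b → ∑F (λ c → 𝟙 (0# ≟ a))))
        ≡⟨ cong₂ _+ℕ_ (sym (∑M-entries _)) zero-first-row ⟩
      |SL2| +ℕ size *ℕ size ∎
      where
      zero-first-row : ∑F (λ a → ∑F (λ b → ∑F (λ c → 𝟙 (0# ≟ a)))) ≡ size *ℕ size
      zero-first-row = begin
        ∑F (λ a → ∑F (λ b → ∑F (λ c → 𝟙 (0# ≟ a))))   ≡⟨ ∑-cong (elems F) (λ a → trans (∑-cong (elems F) (λ b → ∑F-const _)) (∑F-const _)) ⟩
        ∑F (λ a → size *ℕ (size *ℕ 𝟙 (0# ≟ a)))       ≡⟨ trans (∑-*ˡ size _ (elems F)) (cong (size *ℕ_) (∑-*ˡ size _ (elems F))) ⟩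
        size *ℕ (size *ℕ ∑F (λ a → 𝟙 (0# ≟ a)))       ≡⟨ cong (λ z → size *ℕ (size *ℕ z)) (Enumeration.once elements 0#) ⟩
        size *ℕ (size *ℕ 1)                           ≡⟨ cong (size *ℕ_) (ℕ.*-identityʳ size) ⟩
        size *ℕ size                                  ∎

module MatrixAlgebra (F : FiniteField) where

  open FiniteField F
  open import Data.Vec.N-ary using (N-ary)
  open import Relation.Binary.PropositionalEquality
  open IntegerSolver F
  open MatrixEnumeration F using (mat-cong)

  module S {n} = MatrixPolynomials (syntax-rawRing n)
  open S using (_⊙_)
  open ≡-Reasoning

  infixl 7 _∙_
  _∙_ : Mat2 F → Mat2 F → Mat2 F
  _∙_ = _·_ F

  I : Mat2 F
  I = mat 1# 0# 0# 1#

  over₁ : ∀ {n} {X : Set} → (S.Matrix {n} → X) → N-ary 4 (Expr ℤ′ n) X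
  over₁ f a b c d = f (S.matrix a b c d)

  over₂ : ∀ {n} {X : Set} → (S.Matrix {n} → S.Matrix {n} → X) → N-ary 8 (Expr ℤ′ n) X
  over₂ f a b c d a' b' c' d' = f (S.matrix a b c d) (S.matrix a' b' c' d')

  over₃ : ∀ {n} {X : Set} → (S.Matrix {n} → S.Matrix {n} → S.Matrix {n} → X) → N-ary 12 (Expr ℤ′ n) X
  over₃ f a b c d a' b' c' d' a'' b'' c'' d'' = f (S.matrix a b c d) (S.matrix a' b' c' d') (S.matrix a'' b'' c'' d'')

  ∙-assoc : ∀ A B C → (A ∙ B) ∙ C ≡ A ∙ (B ∙ C)
  ∙-assoc (mat a b c d) (mat a' b' c' d') (mat a'' b'' c'' d'') = mat-cong
    (solve 12 (over₃ λ A B C → S.Matrix.a ((A ⊙ B) ⊙ C) ⊜ S.Matrix.a (A ⊙ (B ⊙ C))) refl a b c d a' b' c' d' a'' b'' c'' d'')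
    (solve 12 (over₃ λ A B C → S.Matrix.b ((A ⊙ B) ⊙ C) ⊜ S.Matrix.b (A ⊙ (B ⊙ C))) refl a b c d a' b' c' d' a'' b'' c'' d'')
    (solve 12 (over₃ λ A B C → S.Matrix.c ((A ⊙ B) ⊙ C) ⊜ S.Matrix.c (A ⊙ (B ⊙ C))) refl a b c d a' b' c' d' a'' b'' c'' d'')
    (solve 12 (over₃ λ A B C → S.Matrix.d ((A ⊙ B) ⊙ C) ⊜ S.Matrix.d (A ⊙ (B ⊙ C))) refl a b c d a' b' c' d' a'' b'' c'' d'')

  ∙-identityˡ : ∀ A → I ∙ A ≡ A
  ∙-identityˡ (mat a b c d) = mat-cong
    (solve 2 (λ a c → #1 ⊗ a ⊕ #0 ⊗ c ⊜ a) refl a c) (solve 2 (λ b d → #1 ⊗ b ⊕ #0 ⊗ d ⊜ b) refl b d)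
    (solve 2 (λ a c → #0 ⊗ a ⊕ #1 ⊗ c ⊜ c) refl a c) (solve 2 (λ b d → #0 ⊗ b ⊕ #1 ⊗ d ⊜ d) refl b d)

  ∙-identityʳ : ∀ A → A ∙ I ≡ A
  ∙-identityʳ (mat a b c d) = mat-cong
    (solve 2 (λ a b → a ⊗ #1 ⊕ b ⊗ #0 ⊜ a) refl a b) (solve 2 (λ a b → a ⊗ #0 ⊕ b ⊗ #1 ⊜ b) refl a b)
    (solve 2 (λ c d → c ⊗ #1 ⊕ d ⊗ #0 ⊜ c) refl c d) (solve 2 (λ c d → c ⊗ #0 ⊕ d ⊗ #1 ⊜ d) refl c d)

  adjugate-inverseˡ : ∀ A → det F A ≡ 1# → invSL F A ∙ A ≡ I
  adjugate-inverseˡ (mat a b c d) det≡1 = mat-cong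
    (trans (solve 4 (over₁ λ A → S.Matrix.a (S.adjugate A ⊙ A) ⊜ S.determinant A) refl a b c d) det≡1)
    (solve 4 (over₁ λ A → S.Matrix.b (S.adjugate A ⊙ A) ⊜ #0) refl a b c d)
    (solve 4 (over₁ λ A → S.Matrix.c (S.adjugate A ⊙ A) ⊜ #0) refl a b c d)
    (trans (solve 4 (over₁ λ A → S.Matrix.d (S.adjugate A ⊙ A) ⊜ S.determinant A) refl a b c d) det≡1)

  adjugate-inverseʳ : ∀ A → det F A ≡ 1# → A ∙ invSL F A ≡ I
  adjugate-inverseʳ (mat a b c d) det≡1 = mat-cong
    (trans (solve 4 (over₁ λ A → S.Matrix.a (A ⊙ S.adjugate A) ⊜ S.determinant A) refl a b c d) det≡1)
    (solve 4 (over₁ λ A → S.Matrix.b (A ⊙ S.adjugate A) ⊜ #0) refl a b c d)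
    (solve 4 (over₁ λ A → S.Matrix.c (A ⊙ S.adjugate A) ⊜ #0) refl a b c d)
    (trans (solve 4 (over₁ λ A → S.Matrix.d (A ⊙ S.adjugate A) ⊜ S.determinant A) refl a b c d) det≡1)

  det-∙ : ∀ A B → det F (A ∙ B) ≡ det F A * det F B
  det-∙ (mat a b c d) (mat a' b' c' d') =
    solve 8 (over₂ λ A B → S.determinant (A ⊙ B) ⊜ S.determinant A ⊗ S.determinant B) refl a b c d a' b' c' d'

  det-adjugate : ∀ A → det F (invSL F A) ≡ det F A
  det-adjugate (mat a b c d) = solve 4 (over₁ λ A → S.determinant (S.adjugate A) ⊜ S.determinant A) refl a b c d

module ConicIdentities (F : FiniteField) where

  open FiniteField F
  open import Relation.Binary.PropositionalEquality
  open IntegerSolver F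

  open Polynomials field-rawRing public
  module Sym {n} = Polynomials (syntax-rawRing n)

  conic-on-line : ∀ v w y p₁ p₂ s t →
    conic v w y (p₁ + s * t) (p₂ + t) ≡ conic v w y p₁ p₂ + t * (chord-linear v w y p₁ p₂ s + t * chord-quadratic w s)
  conic-on-line = solve 7 (λ v w y p₁ p₂ s t →
    Sym.conic v w y (p₁ ⊕ s ⊗ t) (p₂ ⊕ t) ⊜ Sym.conic v w y p₁ p₂ ⊕ t ⊗ (Sym.chord-linear v w y p₁ p₂ s ⊕ t ⊗ Sym.chord-quadratic w s)) refl

  -- Lines through p lying on the conic witness s · discriminant ∈ (Q, L, K(p)).
  chord-certificate : ∀ v w y p₁ p₂ s → s * discriminant v w y ≡
    multiplier-quadratic v w y p₁ p₂ s * chord-quadratic w s + multiplier-linear v w y p₁ p₂ s * chord-linear v w y p₁ p₂ s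
    + multiplier-conic w s * conic v w y p₁ p₂
  chord-certificate = solve 6 (λ v w y p₁ p₂ s → s ⊗ Sym.discriminant v w y ⊜
    Sym.multiplier-quadratic v w y p₁ p₂ s ⊗ Sym.chord-quadratic w s ⊕ Sym.multiplier-linear v w y p₁ p₂ s ⊗ Sym.chord-linear v w y p₁ p₂ s
    ⊕ Sym.multiplier-conic w s ⊗ Sym.conic v w y p₁ p₂) refl

  horizontal-factorisation : ∀ v w y m₁ p₁ p₂ →
    (m₁ + - p₁) * (m₁ + (p₁ + w * p₂ + - v)) ≡ conic v w y m₁ p₂ + - conic v w y p₁ p₂
  horizontal-factorisation = solve 6 (λ v w y m₁ p₁ p₂ →
    (m₁ ⊕ ⊝ p₁) ⊗ (m₁ ⊕ (p₁ ⊕ w ⊗ p₂ ⊕ ⊝ v)) ⊜ Sym.conic v w y m₁ p₂ ⊕ ⊝ Sym.conic v w y p₁ p₂) refl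

  -- In characteristic two the conic a² − b² − 1 = 0 is the double line (a + b + 1)² = 0.
  conic-square : ∀ a b → (a + b + 1#) * (a + b + 1#) ≡ conic 0# 0# 0# a b + two * (a * b + a + b + b * b + 1#)
  conic-square = solve 2 (λ a b →
    (a ⊕ b ⊕ #1) ⊗ (a ⊕ b ⊕ #1) ⊜ Sym.conic #0 #0 #0 a b ⊕ Sym.two ⊗ (a ⊗ b ⊕ a ⊕ b ⊕ b ⊗ b ⊕ #1)) refl

module Conics (F : FiniteField) where

  open FiniteField F
  open import Data.Nat as ℕ using (ℕ) renaming (_*_ to _*ℕ_; _≤_ to _≤ℕ_)
  import Data.Nat.Properties as ℕ
  open import Data.Product using (_×_; _,_)
  open import Data.Sum using (_⊎_; inj₁; inj₂)
  open import Data.Empty using (⊥-elim)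
  open import Relation.Nullary using (Dec)
  open import Relation.Binary.PropositionalEquality
  open import Function using (case_of_)
  open FiniteSums
  open Enumerations
  open FieldFacts F
  open IntegerSolver F
  open ConicIdentities F public
  open import Algebra.Bundles using (CommutativeRing)
  open CommutativeRing ring using (+-identityˡ; zeroˡ)

  points : Enumeration (Carrier × Carrier)
  points = ×-enumeration elements elements

  module Points = EnumerationProperties points

  OnConic : Carrier → Carrier → Carrier → Carrier × Carrier → Set
  OnConic v w y (m₁ , m₂) = conic v w y m₁ m₂ ≡ 0#

  onConic? : ∀ v w y m → Dec (OnConic v w y m)
  onConic? v w y (m₁ , m₂) = conic v w y m₁ m₂ ≟ 0#

  #conic : Carrier → Carrier → Carrier → ℕ
  #conic v w y = Points.count (onConic? v w y)

  ∑-plane : (f : Carrier × Carrier → ℕ) → ∑ f (Enumeration.list points) ≡ ∑F (λ a → ∑F (λ b → f (a , b)))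
  ∑-plane f = trans (∑-concatMap f _ (elems F)) (∑-cong (elems F) (λ a → ∑-map f (a ,_) (elems F)))

  -- Every conic has at most 2q points: for fixed m₁, −K is monic quadratic in m₂.
  #conic≤2q : ∀ v w y → #conic v w y ≤ℕ size *ℕ 2
  #conic≤2q v w y = begin
    #conic v w y                            ≡⟨ ∑-plane _ ⟩
    ∑F (λ m₁ → ∑F (λ m₂ → 𝟙 (conic v w y m₁ m₂ ≟ 0#)))
      ≤⟨ ∑-mono (elems F) (λ m₁ → ℕ.≤-trans (∑-mono (elems F) (λ m₂ → 𝟙-mono (conic v w y m₁ m₂ ≟ 0#) (quadratic? m₁ m₂) (as-quadratic m₁ m₂)))
                                           (quadratic-roots _ _)) ⟩
    ∑F (λ _ → 2)                            ≡⟨ ∑F-const 2 ⟩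
    size *ℕ 2                               ∎
    where
    open ℕ.≤-Reasoning
    quadratic? : ∀ m₁ m₂ → Dec (m₂ * m₂ + (- (w * m₁) + - y) * m₂ + (- (m₁ * m₁) + v * m₁ + 1#) ≡ 0#)
    quadratic? m₁ m₂ = (m₂ * m₂ + (- (w * m₁) + - y) * m₂ + (- (m₁ * m₁) + v * m₁ + 1#)) ≟ 0#
    as-quadratic : ∀ m₁ m₂ → conic v w y m₁ m₂ ≡ 0# → m₂ * m₂ + (- (w * m₁) + - y) * m₂ + (- (m₁ * m₁) + v * m₁ + 1#) ≡ 0#
    as-quadratic m₁ m₂ e = trans (solve 5 (λ v w y m₁ m₂ →
        m₂ ⊗ m₂ ⊕ (⊝ (w ⊗ m₁) ⊕ ⊝ y) ⊗ m₂ ⊕ (⊝ (m₁ ⊗ m₁) ⊕ v ⊗ m₁ ⊕ #1) ⊜ ⊝ Sym.conic v w y m₁ m₂) refl v w y m₁ m₂)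
      (trans (cong -_ e) (solve 0 (⊝ #0 ⊜ #0) refl))

  -- A line of slope s lying on a conic has s ≠ 0, since s (s + w) = Q(s) + 1.
  chord-slope-nonzero : ∀ w s → chord-quadratic w s ≡ 0# → s ≢ 0#
  chord-slope-nonzero w s q≡0 s≡0 = 0≢1 (begin
    0#                           ≡⟨ sym (zeroˡ (s + w)) ⟩
    0# * (s + w)                 ≡⟨ cong (λ z → z * (s + w)) (sym s≡0) ⟩
    s * (s + w)                  ≡⟨ solve 2 (λ w s → s ⊗ (s ⊕ w) ⊜ Sym.chord-quadratic w s ⊕ #1) refl w s ⟩
    chord-quadratic w s + 1#     ≡⟨ cong (_+ 1#) q≡0 ⟩
    0# + 1#                      ≡⟨ +-identityˡ 1# ⟩
    1#                           ∎)
    where open ≡-Reasoning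

  -- A nondegenerate conic contains no line: if the line through p with slope s
  -- lies on it, then s · discriminant = 0 with s ≠ 0.
  line-on-conic⇒degenerate : ∀ v w y p₁ p₂ s → chord-quadratic w s ≡ 0# → chord-linear v w y p₁ p₂ s ≡ 0# →
    conic v w y p₁ p₂ ≡ 0# → discriminant v w y ≡ 0#
  line-on-conic⇒degenerate v w y p₁ p₂ s q≡0 l≡0 k≡0 = case zero-product s (discriminant v w y) s·disc≡0 of λ where
      (inj₁ s≡0) → ⊥-elim (chord-slope-nonzero w s q≡0 s≡0)
      (inj₂ disc≡0) → disc≡0
    where
    open ≡-Reasoning
    Mq Ml Mc : Carrier
    Mq = multiplier-quadratic v w y p₁ p₂ s
    Ml = multiplier-linear v w y p₁ p₂ s
    Mc = multiplier-conic w s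
    s·disc≡0 : s * discriminant v w y ≡ 0#
    s·disc≡0 = begin
      s * discriminant v w y
        ≡⟨ chord-certificate v w y p₁ p₂ s ⟩
      Mq * chord-quadratic w s + Ml * chord-linear v w y p₁ p₂ s + Mc * conic v w y p₁ p₂
        ≡⟨ cong₂ (λ a b → Mq * a + Ml * b + Mc * conic v w y p₁ p₂) q≡0 l≡0 ⟩
      Mq * 0# + Ml * 0# + Mc * conic v w y p₁ p₂
        ≡⟨ cong (λ c → Mq * 0# + Ml * 0# + Mc * c) k≡0 ⟩
      Mq * 0# + Ml * 0# + Mc * 0#
        ≡⟨ solve 3 (λ a b c → a ⊗ #0 ⊕ b ⊗ #0 ⊕ c ⊗ #0 ⊜ #0) refl Mq Ml Mc ⟩
      0# ∎

  horizontal-points : ∀ v w y p₁ p₂ m₁ → conic v w y p₁ p₂ ≡ 0# → conic v w y m₁ p₂ ≡ 0# →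
    p₁ ≡ m₁ ⊎ - (p₁ + w * p₂ + - v) ≡ m₁
  horizontal-points v w y p₁ p₂ m₁ on-p on-m = case zero-product (m₁ + - p₁) (m₁ + (p₁ + w * p₂ + - v)) product≡0 of λ where
      (inj₁ e) → inj₁ (sym (difference-zero m₁ p₁ e))
      (inj₂ e) → inj₂ (sum-zero m₁ (p₁ + w * p₂ + - v) e)
    where
    product≡0 : (m₁ + - p₁) * (m₁ + (p₁ + w * p₂ + - v)) ≡ 0#
    product≡0 = trans (horizontal-factorisation v w y m₁ p₁ p₂)
                  (trans (cong₂ (λ a b → a + - b) on-m on-p) (solve 0 (#0 ⊕ ⊝ #0 ⊜ #0) refl))

module ConicCounts (F : FiniteField) where

  open FiniteField F
  open import Data.Nat as ℕ using (ℕ; z≤n) renaming (_+_ to _+ℕ_; _*_ to _*ℕ_; _≤_ to _≤ℕ_)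
  import Data.Nat.Properties as ℕ
  open import Data.Product using (_×_; _,_; proj₁; proj₂)
  open import Data.Sum using (inj₁; inj₂)
  open import Data.Empty using (⊥-elim)
  open import Relation.Nullary using (¬_; Dec; yes; no; ¬?)
  open import Relation.Nullary.Decidable using (_×-dec_)
  open import Relation.Binary.PropositionalEquality
  open import Function using (case_of_)
  open FiniteSums
  open Enumerations
  open FieldFacts F
  open IntegerSolver F
  open Conics F
  open import Algebra.Bundles using (CommutativeRing)
  open CommutativeRing ring using (+-identityˡ)

  -- Counting the points of a nondegenerate conic through a known point p:
  -- every point off the horizontal line through p is determined by the slope
  -- of the chord joining it to p, so there are at most q of them.
  module ChordCount (v w y : Carrier) (nondegenerate : discriminant v w y ≢ 0#)
                    (p₁ p₂ : Carrier) (on-p : conic v w y p₁ p₂ ≡ 0#) where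

    slope : Carrier × Carrier → Carrier
    slope (m₁ , m₂) = (m₁ + - p₁) * (m₂ + - p₂) ⁻¹

    Off : Carrier × Carrier → Set
    Off (m₁ , m₂) = (m₂ ≢ p₂) × OnConic v w y (m₁ , m₂)

    off? : ∀ m → Dec (Off m)
    off? (m₁ , m₂) = ¬? (m₂ ≟ p₂) ×-dec onConic? v w y (m₁ , m₂)

    -- Such a point is p + t (s, 1) with t = m₂ − p₂ ≠ 0, and then the chord
    -- equation L + t Q = 0 holds.
    chord-point : ∀ m₁ m₂ s → Off (m₁ , m₂) → slope (m₁ , m₂) ≡ s →
      (p₁ + s * (m₂ + - p₂) ≡ m₁) × (chord-linear v w y p₁ p₂ s + (m₂ + - p₂) * chord-quadratic w s ≡ 0#)
    chord-point m₁ m₂ s (m₂≢p₂ , on-m) slope≡s = first-coordinate , chord-equation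
      where
      open ≡-Reasoning
      t = m₂ + - p₂
      t≢0 : t ≢ 0#
      t≢0 e = m₂≢p₂ (difference-zero m₂ p₂ e)
      first-coordinate : p₁ + s * t ≡ m₁
      first-coordinate = begin
        p₁ + s * t                                  ≡⟨ cong (λ z → p₁ + z * t) (sym slope≡s) ⟩
        p₁ + ((m₁ + - p₁) * t ⁻¹) * t
          ≡⟨ solve 4 (λ p₁ m₁ i t → p₁ ⊕ ((m₁ ⊕ ⊝ p₁) ⊗ i) ⊗ t ⊜ m₁ ⊕ (m₁ ⊕ ⊝ p₁) ⊗ (t ⊗ i ⊕ ⊝ #1)) refl p₁ m₁ (t ⁻¹) t ⟩
        m₁ + (m₁ + - p₁) * (t * t ⁻¹ + - 1#)        ≡⟨ cong (λ z → m₁ + (m₁ + - p₁) * (z + - 1#)) (⁻¹-inverse t t≢0) ⟩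
        m₁ + (m₁ + - p₁) * (1# + - 1#)              ≡⟨ solve 2 (λ m₁ p₁ → m₁ ⊕ (m₁ ⊕ ⊝ p₁) ⊗ (#1 ⊕ ⊝ #1) ⊜ m₁) refl m₁ p₁ ⟩
        m₁                                          ∎
      t·chord≡0 : t * (chord-linear v w y p₁ p₂ s + t * chord-quadratic w s) ≡ 0#
      t·chord≡0 = begin
        t * (chord-linear v w y p₁ p₂ s + t * chord-quadratic w s)
          ≡⟨ sym (+-identityˡ _) ⟩
        0# + t * (chord-linear v w y p₁ p₂ s + t * chord-quadratic w s)
          ≡⟨ cong (_+ t * (chord-linear v w y p₁ p₂ s + t * chord-quadratic w s)) (sym on-p) ⟩
        conic v w y p₁ p₂ + t * (chord-linear v w y p₁ p₂ s + t * chord-quadratic w s)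
          ≡⟨ sym (conic-on-line v w y p₁ p₂ s t) ⟩
        conic v w y (p₁ + s * t) (p₂ + t)
          ≡⟨ cong₂ (conic v w y) first-coordinate (solve 2 (λ p₂ m₂ → p₂ ⊕ (m₂ ⊕ ⊝ p₂) ⊜ m₂) refl p₂ m₂) ⟩
        conic v w y m₁ m₂
          ≡⟨ on-m ⟩
        0# ∎
      chord-equation : chord-linear v w y p₁ p₂ s + t * chord-quadratic w s ≡ 0#
      chord-equation = case zero-product t _ t·chord≡0 of λ where
        (inj₁ t≡0) → ⊥-elim (t≢0 t≡0)
        (inj₂ e) → e

    -- Two points off the horizontal line with the same slope coincide, since
    -- otherwise the whole chord would lie on the (nondegenerate) conic.
    same-slope⇒same-point : ∀ s m m' → slope m ≡ s × Off m → slope m' ≡ s × Off m' → m ≡ m'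
    same-slope⇒same-point s (m₁ , m₂) (m₁' , m₂') (slope≡s , off) (slope'≡s , off') =
      case zero-product (t + - t') Q difference≡0 of λ where
        (inj₁ t-t'≡0) → same-point t-t'≡0
        (inj₂ Q≡0) → ⊥-elim (nondegenerate (line-on-conic⇒degenerate v w y p₁ p₂ s Q≡0 (L≡0 Q≡0) on-p))
      where
      t = m₂ + - p₂
      t' = m₂' + - p₂
      L = chord-linear v w y p₁ p₂ s
      Q = chord-quadratic w s
      on-chord = chord-point m₁ m₂ s off slope≡s
      on-chord' = chord-point m₁' m₂' s off' slope'≡s
      difference≡0 : (t + - t') * Q ≡ 0#
      difference≡0 = trans (solve 4 (λ t t' L Q → (t ⊕ ⊝ t') ⊗ Q ⊜ (L ⊕ t ⊗ Q) ⊕ ⊝ (L ⊕ t' ⊗ Q)) refl t t' L Q)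
                           (trans (cong₂ (λ a b → a + - b) (proj₂ on-chord) (proj₂ on-chord')) (solve 0 (#0 ⊕ ⊝ #0 ⊜ #0) refl))
      same-point : t + - t' ≡ 0# → (m₁ , m₂) ≡ (m₁' , m₂')
      same-point t-t'≡0 = cong₂ _,_
        (trans (sym (proj₁ on-chord)) (trans (cong (λ z → p₁ + s * z) t≡t') (proj₁ on-chord')))
        (difference-zero m₂ m₂' (trans (solve 3 (λ m₂ m₂' p₂ → m₂ ⊕ ⊝ m₂' ⊜ (m₂ ⊕ ⊝ p₂) ⊕ ⊝ (m₂' ⊕ ⊝ p₂)) refl m₂ m₂' p₂) t-t'≡0))
        where
        t≡t' : t ≡ t'
        t≡t' = difference-zero t t' t-t'≡0
      L≡0 : Q ≡ 0# → L ≡ 0#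
      L≡0 Q≡0 = trans (sym (solve 3 (λ L t Q → L ⊕ t ⊗ #0 ⊜ L) refl L t Q))
                      (trans (cong (λ z → L + t * z) (sym Q≡0)) (proj₂ on-chord))

    #off≤q : Points.count off? ≤ℕ size
    #off≤q = begin
      Points.count off?
        ≡⟨ Elements.∑-fibres (Enumeration.list points) slope (λ m → 𝟙 (off? m)) ⟩
      ∑F (λ s → ∑ (λ m → 𝟙 (slope m ≟ s) *ℕ 𝟙 (off? m)) (Enumeration.list points))
        ≤⟨ ∑-mono (elems F) (λ s → ℕ.≤-trans (ℕ.≤-reflexive (∑-cong (Enumeration.list points) (λ m → sym (𝟙-× (slope m ≟ s) (off? m)))))
                                             (Points.count≤1 (λ m → (slope m ≟ s) ×-dec off? m) (same-slope⇒same-point s))) ⟩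
      ∑F (λ _ → 1)
        ≡⟨ size-as-count ⟩
      size ∎
      where open ℕ.≤-Reasoning

    -- The second point of the conic on the horizontal line through p.
    p' : Carrier × Carrier
    p' = (- (p₁ + w * p₂ + - v) , p₂)

    at-p at-p' : Carrier × Carrier → ℕ
    at-p m = 𝟙 (Enumeration._≟_ points (p₁ , p₂) m)
    at-p' m = 𝟙 (Enumeration._≟_ points p' m)

    trichotomy : ∀ m → OnConic v w y m → 1 ≤ℕ at-p m +ℕ (at-p' m +ℕ 𝟙 (off? m))
    trichotomy (m₁ , m₂) on-m = case m₂ ≟ p₂ of λ where
      (no m₂≢p₂) → ℕ.≤-trans (ℕ.≤-reflexive (sym (𝟙-yes (off? (m₁ , m₂)) (m₂≢p₂ , on-m))))
                             (ℕ.≤-trans (ℕ.m≤n+m _ (at-p' (m₁ , m₂))) (ℕ.m≤n+m _ (at-p (m₁ , m₂))))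
      (yes refl) → case horizontal-points v w y p₁ p₂ m₁ on-p on-m of λ where
        (inj₁ e) → ℕ.≤-trans (ℕ.≤-reflexive (sym (𝟙-yes (Enumeration._≟_ points (p₁ , p₂) (m₁ , p₂)) (cong (_, p₂) e))))
                             (ℕ.m≤m+n (at-p (m₁ , p₂)) _)
        (inj₂ e) → ℕ.≤-trans (ℕ.≤-trans (ℕ.≤-reflexive (sym (𝟙-yes (Enumeration._≟_ points p' (m₁ , p₂)) (cong (_, p₂) e))))
                                       (ℕ.m≤m+n (at-p' (m₁ , p₂)) (𝟙 (off? (m₁ , p₂)))))
                             (ℕ.m≤n+m _ (at-p (m₁ , p₂)))

    covered : ∀ m → 𝟙 (onConic? v w y m) ≤ℕ at-p m +ℕ (at-p' m +ℕ 𝟙 (off? m))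
    covered m = case onConic? v w y m of λ where
      (no off) → ℕ.≤-trans (ℕ.≤-reflexive (𝟙-no (onConic? v w y m) off)) z≤n
      (yes on-m) → ℕ.≤-trans (ℕ.≤-reflexive (𝟙-yes (onConic? v w y m) on-m)) (trichotomy m on-m)

    #conic≤q+2-given-point : #conic v w y ≤ℕ size +ℕ 2
    #conic≤q+2-given-point = begin
      #conic v w y
        ≤⟨ ∑-mono (Enumeration.list points) covered ⟩
      ∑ (λ m → at-p m +ℕ (at-p' m +ℕ 𝟙 (off? m))) (Enumeration.list points)
        ≡⟨ trans (∑-+ at-p _ (Enumeration.list points))
                 (cong₂ _+ℕ_ (Enumeration.once points (p₁ , p₂))
                             (trans (∑-+ at-p' (λ m → 𝟙 (off? m)) (Enumeration.list points))
                                    (cong (_+ℕ Points.count off?) (Enumeration.once points p')))) ⟩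
      1 +ℕ (1 +ℕ Points.count off?)
        ≤⟨ ℕ.+-monoʳ-≤ 2 #off≤q ⟩
      2 +ℕ size
        ≡⟨ ℕ.+-comm 2 size ⟩
      size +ℕ 2 ∎
      where open ℕ.≤-Reasoning

  #conic≤q+2 : ∀ v w y → discriminant v w y ≢ 0# → #conic v w y ≤ℕ size +ℕ 2
  #conic≤q+2 v w y nondegenerate = count-from-witness (onConic? v w y) (Enumeration.list points) (size +ℕ 2)
    λ (p₁ , p₂) on-p → ChordCount.#conic≤q+2-given-point v w y nondegenerate p₁ p₂ on-p

  -- In characteristic two, a² − b² − 1 = 0 is the line a + b + 1 = 0, with q points.
  #conic≤q-char2 : two ≡ 0# → #conic 0# 0# 0# ≤ℕ size
  #conic≤q-char2 two≡0 = begin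
    #conic 0# 0# 0#                         ≡⟨ ∑-plane _ ⟩
    ∑F (λ a → ∑F (λ b → 𝟙 (conic 0# 0# 0# a b ≟ 0#)))
      ≤⟨ ∑-mono (elems F) (λ a → ∑-mono (elems F) (λ b → 𝟙-mono (conic 0# 0# 0# a b ≟ 0#) ((- (a + 1#)) ≟ b) (on-line a b))) ⟩
    ∑F (λ a → ∑F (λ b → 𝟙 ((- (a + 1#)) ≟ b)))  ≡⟨ ∑-cong (elems F) (λ a → Enumeration.once elements (- (a + 1#))) ⟩
    ∑F (λ _ → 1)                            ≡⟨ size-as-count ⟩
    size                                    ∎
    where
    open ℕ.≤-Reasoning
    on-line : ∀ a b → conic 0# 0# 0# a b ≡ 0# → - (a + 1#) ≡ b
    on-line a b on-ab = sum-zero b (a + 1#) (trans (solve 2 (λ b a → b ⊕ (a ⊕ #1) ⊜ a ⊕ b ⊕ #1) refl b a) (square-zero _ square≡0))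
      where
      square≡0 : (a + b + 1#) * (a + b + 1#) ≡ 0#
      square≡0 = trans (conic-square a b)
        (trans (cong₂ (λ k t → k + t * (a * b + a + b + b * b + 1#)) on-ab two≡0)
               (solve 1 (λ x → #0 ⊕ #0 ⊗ x ⊜ #0) refl (a * b + a + b + b * b + 1#)))

module Conjugation (F : FiniteField) where

  open FiniteField F
  open import Data.Nat as ℕ using (ℕ) renaming (_*_ to _*ℕ_; _≤_ to _≤ℕ_)
  import Data.Nat.Properties as ℕ
  open import Data.Product using (_×_; _,_)
  open import Relation.Nullary using (Dec)
  open import Relation.Nullary.Decidable using (_×-dec_)
  open import Relation.Binary.PropositionalEquality using (_≡_; refl; sym; trans; cong; cong₂; subst; module ≡-Reasoning)
  open FiniteSums
  open Enumerations
  open FieldFacts F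
  open IntegerSolver F
  open MatrixEnumeration F
  open MatrixAlgebra F
  open Conics F

  J : Carrier → Mat2 F
  J v = mat v 1# 1# 0#

  φ : Carrier → Mat2 F → Mat2 F
  φ v u = invSL F u ∙ (J v ∙ u)

  conjugation-cancel : ∀ v u → det F u ≡ 1# → u ∙ φ v u ≡ J v ∙ u
  conjugation-cancel v u det≡1 = begin
    u ∙ (invSL F u ∙ (J v ∙ u))     ≡⟨ sym (∙-assoc u (invSL F u) (J v ∙ u)) ⟩
    (u ∙ invSL F u) ∙ (J v ∙ u)     ≡⟨ cong (_∙ (J v ∙ u)) (adjugate-inverseʳ u det≡1) ⟩
    I ∙ (J v ∙ u)                   ≡⟨ ∙-identityˡ (J v ∙ u) ⟩
    J v ∙ u                         ∎
    where open ≡-Reasoning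

  fibre-commutes : ∀ v u u₀ → det F u ≡ 1# → det F u₀ ≡ 1# → φ v u ≡ φ v u₀ →
    J v ∙ (u ∙ invSL F u₀) ≡ (u ∙ invSL F u₀) ∙ J v
  fibre-commutes v u u₀ det≡1 det₀≡1 same = begin
    J v ∙ (u ∙ u₀⁻¹)                  ≡⟨ sym (∙-assoc (J v) u u₀⁻¹) ⟩
    (J v ∙ u) ∙ u₀⁻¹                  ≡⟨ cong (_∙ u₀⁻¹) (sym (conjugation-cancel v u det≡1)) ⟩
    (u ∙ φ v u) ∙ u₀⁻¹                ≡⟨ cong (λ P → (u ∙ P) ∙ u₀⁻¹) same ⟩
    (u ∙ (u₀⁻¹ ∙ (J v ∙ u₀))) ∙ u₀⁻¹  ≡⟨ cong (_∙ u₀⁻¹) (sym (∙-assoc u u₀⁻¹ (J v ∙ u₀))) ⟩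
    (g ∙ (J v ∙ u₀)) ∙ u₀⁻¹           ≡⟨ ∙-assoc g (J v ∙ u₀) u₀⁻¹ ⟩
    g ∙ ((J v ∙ u₀) ∙ u₀⁻¹)           ≡⟨ cong (g ∙_) (∙-assoc (J v) u₀ u₀⁻¹) ⟩
    g ∙ (J v ∙ (u₀ ∙ u₀⁻¹))           ≡⟨ cong (λ P → g ∙ (J v ∙ P)) (adjugate-inverseʳ u₀ det₀≡1) ⟩
    g ∙ (J v ∙ I)                     ≡⟨ cong (g ∙_) (∙-identityʳ (J v)) ⟩
    g ∙ J v                           ∎
    where
    open ≡-Reasoning
    u₀⁻¹ = invSL F u₀
    g = u ∙ u₀⁻¹

  centraliser-shape : ∀ v g → J v ∙ g ≡ g ∙ J v → g ≡ mat (v * Mat2.b g + Mat2.d g) (Mat2.b g) (Mat2.b g) (Mat2.d g)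
  centraliser-shape v (mat g₁ g₂ g₃ g₄) commutes = mat-cong
    (trans (sym (solve 4 (λ g₁ g₂ g₃ g₄ → g₁ ⊗ #1 ⊕ g₂ ⊗ #0 ⊜ g₁) refl g₁ g₂ g₃ g₄))
           (trans (sym (cong Mat2.b commutes)) (solve 3 (λ v g₂ g₄ → v ⊗ g₂ ⊕ #1 ⊗ g₄ ⊜ v ⊗ g₂ ⊕ g₄) refl v g₂ g₄)))
    refl
    (trans (sym (solve 2 (λ g₃ g₄ → g₃ ⊗ #1 ⊕ g₄ ⊗ #0 ⊜ g₃) refl g₃ g₄))
           (trans (sym (cong Mat2.d commutes)) (solve 2 (λ g₂ g₄ → #1 ⊗ g₂ ⊕ #0 ⊗ g₄ ⊜ g₂) refl g₂ g₄)))
    refl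

  centraliser-conic : ∀ v g₂ g₄ → conic 0# v 0# g₄ g₂ ≡ det F (mat (v * g₂ + g₄) g₂ g₂ g₄) + - 1#
  centraliser-conic = solve 3 (λ v g₂ g₄ → Sym.conic #0 v #0 g₄ g₂ ⊜ (v ⊗ g₂ ⊕ g₄) ⊗ g₄ ⊕ ⊝ (g₂ ⊗ g₂) ⊕ ⊝ #1) refl

  centraliser-element : Carrier → Carrier × Carrier → Mat2 F
  centraliser-element v (g₄ , g₂) = mat (v * g₂ + g₄) g₂ g₂ g₄

  module Fibre (v : Carrier) (u₀ : Mat2 F) (det₀≡1 : det F u₀ ≡ 1#) where

    InFibre : Mat2 F → Set
    InFibre u = (det F u ≡ 1#) × (φ v u ≡ φ v u₀)

    key : Mat2 F → Carrier × Carrier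
    key u = (Mat2.d (u ∙ invSL F u₀) , Mat2.b (u ∙ invSL F u₀))

    factorisation : ∀ u → InFibre u → u ≡ centraliser-element v (key u) ∙ u₀
    factorisation u (det≡1 , same) = begin
      u                                ≡⟨ sym (∙-identityʳ u) ⟩
      u ∙ I                            ≡⟨ cong (u ∙_) (sym (adjugate-inverseˡ u₀ det₀≡1)) ⟩
      u ∙ (invSL F u₀ ∙ u₀)            ≡⟨ sym (∙-assoc u (invSL F u₀) u₀) ⟩
      (u ∙ invSL F u₀) ∙ u₀            ≡⟨ cong (_∙ u₀) (centraliser-shape v (u ∙ invSL F u₀) (fibre-commutes v u u₀ det≡1 det₀≡1 same)) ⟩
      centraliser-element v (key u) ∙ u₀ ∎
      where open ≡-Reasoning

    key-injective : ∀ u u' → InFibre u → InFibre u' → key u ≡ key u' → u ≡ u'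
    key-injective u u' in-u in-u' same-key =
      trans (factorisation u in-u) (trans (cong (λ k → centraliser-element v k ∙ u₀) same-key) (sym (factorisation u' in-u')))

    -- The key lies on K_{0,v,0}, since g has determinant one.
    key-on-conic : ∀ u → InFibre u → OnConic 0# v 0# (key u)
    key-on-conic u (det≡1 , same) = begin
      conic 0# v 0# g₄ g₂                               ≡⟨ centraliser-conic v g₂ g₄ ⟩
      det F (centraliser-element v (key u)) + - 1#      ≡⟨ cong (λ h → det F h + - 1#) (sym (centraliser-shape v g (fibre-commutes v u u₀ det≡1 det₀≡1 same))) ⟩
      det F g + - 1#                                    ≡⟨ cong (_+ - 1#) (det-∙ u (invSL F u₀)) ⟩
      det F u * det F (invSL F u₀) + - 1#               ≡⟨ cong₂ (λ a b → a * b + - 1#) det≡1 (trans (det-adjugate u₀) det₀≡1) ⟩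
      1# * 1# + - 1#                                    ≡⟨ solve 0 (#1 ⊗ #1 ⊕ ⊝ #1 ⊜ #0) refl ⟩
      0#                                                ∎
      where
      open ≡-Reasoning
      g = u ∙ invSL F u₀
      g₂ = Mat2.b g
      g₄ = Mat2.d g

  fibre : Carrier → Mat2 F → ℕ
  fibre v M = Matrices.count (λ u → (det F u ≟ 1#) ×-dec (φ v u ≟M M))

  -- Every fibre of φ_v has at most as many elements as the conic K_{0,v,0}:
  -- u ↦ (g₄, g₂), for g = u u₀⁻¹, maps the fibre of φ_v(u₀) injectively to it.
  fibre≤#centraliser : ∀ v M → fibre v M ≤ℕ #conic 0# v 0#
  fibre≤#centraliser v M = count-from-witness InFibre? (allMat F) (#conic 0# v 0#) λ u₀ (det₀≡1 , φu₀≡M) → bound u₀ det₀≡1 φu₀≡M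
    where
    InFibre? : ∀ u → Dec ((det F u ≡ 1#) × (φ v u ≡ M))
    InFibre? u = (det F u ≟ 1#) ×-dec (φ v u ≟M M)
    bound : ∀ u₀ → det F u₀ ≡ 1# → φ v u₀ ≡ M → fibre v M ≤ℕ #conic 0# v 0#
    bound u₀ det₀≡1 refl = begin
      fibre v M
        ≡⟨ Points.∑-fibres (allMat F) key (λ u → 𝟙 (InFibre? u)) ⟩
      ∑ (λ s → ∑ (λ u → 𝟙 (Enumeration._≟_ points (key u) s) *ℕ 𝟙 (InFibre? u)) (allMat F)) (Enumeration.list points)
        ≤⟨ ∑-mono (Enumeration.list points) over-each-point ⟩
      #conic 0# v 0# ∎
      where
      open ℕ.≤-Reasoning
      open Fibre v u₀ det₀≡1
      over-each-point : ∀ s → ∑ (λ u → 𝟙 (Enumeration._≟_ points (key u) s) *ℕ 𝟙 (InFibre? u)) (allMat F) ≤ℕ 𝟙 (onConic? 0# v 0# s)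
      over-each-point s = ℕ.≤-trans
        (ℕ.≤-reflexive (∑-cong (allMat F) (λ u → sym (𝟙-× (Enumeration._≟_ points (key u) s) (InFibre? u)))))
        (Matrices.count≤𝟙 (λ u → Enumeration._≟_ points (key u) s ×-dec InFibre? u) (onConic? 0# v 0# s)
          (λ u u' (k≡s , in-u) (k'≡s , in-u') → key-injective u u' in-u in-u' (trans k≡s (sym k'≡s)))
          (λ u (k≡s , in-u) → subst (OnConic 0# v 0#) k≡s (key-on-conic u in-u)))

module TraceCounts (F : FiniteField) where

  open FiniteField F
  open import Data.Nat as ℕ using (ℕ) renaming (_*_ to _*ℕ_; _≤_ to _≤ℕ_)
  import Data.Nat.Properties as ℕ
  open import Data.Product using (_×_; _,_)
  open import Relation.Nullary using (¬_)
  open import Relation.Nullary.Decidable using (_×-dec_)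
  open import Relation.Binary.PropositionalEquality using (_≡_; refl; sym; trans; cong; cong₂; subst; module ≡-Reasoning)
  open FiniteSums
  open Enumerations
  open FieldFacts F
  open IntegerSolver F
  open MatrixEnumeration F
  open MatrixAlgebra F
  open Conics F
  open Conjugation F
  open S using (_⊙_)

  trace-W : ∀ w P → tr F (mat 0# 1# 1# w ∙ P) ≡ Mat2.c P + Mat2.b P + w * Mat2.d P
  trace-W w (mat a b c d) = solve 5 (λ w a b c d → #0 ⊗ a ⊕ #1 ⊗ c ⊕ (#1 ⊗ b ⊕ w ⊗ d) ⊜ c ⊕ b ⊕ w ⊗ d) refl w a b c d

  trace-φ : ∀ v u → Mat2.d (φ v u) ≡ v * det F u + - Mat2.a (φ v u)
  trace-φ v (mat a b c d) = solve 5 (λ v → over₁ λ U →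
    S.Matrix.d (S.adjugate U ⊙ (S.matrix v #1 #1 #0 ⊙ U)) ⊜ v ⊗ S.determinant U ⊕ ⊝ S.Matrix.a (S.adjugate U ⊙ (S.matrix v #1 #1 #0 ⊙ U)))
    refl v a b c d

  det-φ : ∀ v u → det F (φ v u) ≡ - (det F u * det F u)
  det-φ v u = begin
    det F (invSL F u ∙ (J v ∙ u))                 ≡⟨ det-∙ (invSL F u) (J v ∙ u) ⟩
    det F (invSL F u) * det F (J v ∙ u)           ≡⟨ cong₂ _*_ (det-adjugate u) (det-∙ (J v) u) ⟩
    det F u * (det F (J v) * det F u)             ≡⟨ solve 2 (λ v δ → δ ⊗ ((v ⊗ #0 ⊕ ⊝ (#1 ⊗ #1)) ⊗ δ) ⊜ ⊝ (δ ⊗ δ)) refl v (det F u) ⟩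
    - (det F u * det F u)                         ∎
    where open ≡-Reasoning

  -- The matrix with first row (k₁, k₂), trace v, and Tr(W_w P) = x.
  first-row-matrix : Carrier → Carrier → Carrier → Carrier × Carrier → Mat2 F
  first-row-matrix v w x (k₁ , k₂) = mat k₁ k₂ (x + - k₂ + - (w * (v + - k₁))) (v + - k₁)

  first-row : Mat2 F → Carrier × Carrier
  first-row P = (Mat2.a P , Mat2.b P)

  first-row-conic : ∀ v w x k₁ k₂ → conic v w (x + - (w * v)) k₁ k₂ ≡ - (det F (first-row-matrix v w x (k₁ , k₂)) + 1#)
  first-row-conic = solve 5 (λ v w x k₁ k₂ → Sym.conic v w (x ⊕ ⊝ (w ⊗ v)) k₁ k₂ ⊜
    ⊝ ((k₁ ⊗ (v ⊕ ⊝ k₁) ⊕ ⊝ (k₂ ⊗ (x ⊕ ⊝ k₂ ⊕ ⊝ (w ⊗ (v ⊕ ⊝ k₁))))) ⊕ #1)) refl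

  module _ (v w x : Carrier) (u : Mat2 F) (det≡1 : det F u ≡ 1#) (tr≡x : trWord F v w u ≡ x) where

    private
      P = φ v u
      k₁ = Mat2.a P
      k₂ = Mat2.b P

    φ-from-first-row : φ v u ≡ first-row-matrix v w x (first-row (φ v u))
    φ-from-first-row = mat-cong refl refl entry-c entry-d
      where
      open ≡-Reasoning
      entry-d : Mat2.d P ≡ v + - k₁
      entry-d = begin
        Mat2.d P                 ≡⟨ trace-φ v u ⟩
        v * det F u + - k₁       ≡⟨ cong (λ δ → v * δ + - k₁) det≡1 ⟩
        v * 1# + - k₁            ≡⟨ solve 2 (λ v k → v ⊗ #1 ⊕ ⊝ k ⊜ v ⊕ ⊝ k) refl v k₁ ⟩
        v + - k₁                 ∎
      entry-c : Mat2.c P ≡ x + - k₂ + - (w * (v + - k₁))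
      entry-c = begin
        Mat2.c P                                         ≡⟨ solve 3 (λ c b e → c ⊜ c ⊕ b ⊕ e ⊕ ⊝ b ⊕ ⊝ e) refl (Mat2.c P) k₂ (w * Mat2.d P) ⟩
        Mat2.c P + k₂ + w * Mat2.d P + - k₂ + - (w * Mat2.d P)
          ≡⟨ cong (λ t → t + - k₂ + - (w * Mat2.d P)) (trans (sym (trace-W w P)) tr≡x) ⟩
        x + - k₂ + - (w * Mat2.d P)                      ≡⟨ cong (λ z → x + - k₂ + - (w * z)) entry-d ⟩
        x + - k₂ + - (w * (v + - k₁))                    ∎

    first-row-on-conic : OnConic v w (x + - (w * v)) (first-row (φ v u))
    first-row-on-conic = begin
      conic v w (x + - (w * v)) k₁ k₂                           ≡⟨ first-row-conic v w x k₁ k₂ ⟩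
      - (det F (first-row-matrix v w x (k₁ , k₂)) + 1#)         ≡⟨ cong (λ M → - (det F M + 1#)) (sym φ-from-first-row) ⟩
      - (det F P + 1#)                                          ≡⟨ cong (λ d → - (d + 1#)) (trans (det-φ v u) (cong (λ δ → - (δ * δ)) det≡1)) ⟩
      - (- (1# * 1#) + 1#)                                      ≡⟨ solve 0 (⊝ (⊝ (#1 ⊗ #1) ⊕ #1) ⊜ #0) refl ⟩
      0#                                                        ∎
      where open ≡-Reasoning

  N : Carrier → Carrier → Carrier → ℕ
  N v w x = ∑M (λ u → 𝟙 (det F u ≟ 1#) *ℕ 𝟙 (trWord F v w u ≟ x))

  countD≡N : ∀ v w x → countD F v w x ≡ N v w x
  countD≡N v w x = trans (length-filter (λ u → trWord F v w u ≟ x) (SL2 F))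
                         (∑-filter (λ u → det F u ≟ 1#) _ (allMat F))

  -- Every u ∈ SL(2,q) is counted for exactly one x.
  ∑N≡|SL2| : ∀ v w → ∑F (N v w) ≡ |SL2|
  ∑N≡|SL2| v w = begin
    ∑F (λ x → ∑M (λ u → 𝟙 (det F u ≟ 1#) *ℕ 𝟙 (trWord F v w u ≟ x)))
      ≡⟨ sym (∑-swap (λ u x → 𝟙 (det F u ≟ 1#) *ℕ 𝟙 (trWord F v w u ≟ x)) (allMat F) (elems F)) ⟩
    ∑M (λ u → ∑F (λ x → 𝟙 (det F u ≟ 1#) *ℕ 𝟙 (trWord F v w u ≟ x)))
      ≡⟨ ∑-cong (allMat F) (λ u → ∑-*ˡ (𝟙 (det F u ≟ 1#)) _ (elems F)) ⟩
    ∑M (λ u → 𝟙 (det F u ≟ 1#) *ℕ ∑F (λ x → 𝟙 (trWord F v w u ≟ x)))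
      ≡⟨ ∑-cong (allMat F) (λ u → trans (cong (𝟙 (det F u ≟ 1#) *ℕ_) (Enumeration.once elements (trWord F v w u))) (ℕ.*-identityʳ _)) ⟩
    |SL2| ∎
    where open ≡-Reasoning

  -- N is symmetric in (v, w): transposing the diagonal, (a b; c d) ↦ (d b; c a),
  -- preserves the determinant and exchanges the roles of v and w.
  N-symmetric : ∀ v w x → N w v x ≡ N v w x
  N-symmetric v w x = trans (∑-cong (allMat F) (λ u → cong₂ _*ℕ_ (det-flip u) (word-flip u)))
                            (Matrices.∑-bijection flip flip (λ _ → refl) (λ _ → refl) (λ u → 𝟙 (det F u ≟ 1#) *ℕ 𝟙 (trWord F v w u ≟ x)))
    where
    flip : Mat2 F → Mat2 F
    flip (mat a b c d) = mat d b c a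
    det-flip : ∀ u → 𝟙 (det F u ≟ 1#) ≡ 𝟙 (det F (flip u) ≟ 1#)
    det-flip (mat a b c d) = 𝟙-cong (det F (mat a b c d) ≟ 1#) (det F (mat d b c a) ≟ 1#) (trans flipped) (trans (sym flipped))
      where
      flipped : det F (mat d b c a) ≡ det F (mat a b c d)
      flipped = solve 4 (over₁ λ U → S.determinant (S.matrix (S.Matrix.d U) (S.Matrix.b U) (S.Matrix.c U) (S.Matrix.a U)) ⊜ S.determinant U) refl a b c d
    word-flip : ∀ u → 𝟙 (trWord F w v u ≟ x) ≡ 𝟙 (trWord F v w (flip u) ≟ x)
    word-flip (mat a b c d) = 𝟙-cong (trWord F w v (mat a b c d) ≟ x) (trWord F v w (mat d b c a) ≟ x) (trans flipped) (trans (sym flipped))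
      where
      word : ∀ {n} → Expr ℤ′ n → Expr ℤ′ n → S.Matrix {n} → Expr ℤ′ n
      word v w U = S.Matrix.a M ⊕ S.Matrix.d M
        where M = S.matrix #0 #1 #1 w ⊙ (S.adjugate U ⊙ (S.matrix v #1 #1 #0 ⊙ U))
      flipped : trWord F v w (mat d b c a) ≡ trWord F w v (mat a b c d)
      flipped = solve 6 (λ v w → over₁ λ U →
        word v w (S.matrix (S.Matrix.d U) (S.Matrix.b U) (S.Matrix.c U) (S.Matrix.a U)) ⊜ word w v U) refl v w a b c d

  -- Fibration bound: u ↦ first row of φ_v(u) maps the u counted by N_{v,w}(x)
  -- to points of K_{v,w,x−wv}, with fibres inside fibres of φ_v.
  N≤fibre·#conic : ∀ v w x f → (∀ M → fibre v M ≤ℕ f) → N v w x ≤ℕ #conic v w (x + - (w * v)) *ℕ f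
  N≤fibre·#conic v w x f fibre≤f = begin
    N v w x
      ≡⟨ Points.∑-fibres (allMat F) κ counted ⟩
    ∑ (λ k → ∑M (λ u → 𝟙 (κ u ≟P k) *ℕ counted u)) (Enumeration.list points)
      ≤⟨ ∑-mono (Enumeration.list points) over-point ⟩
    ∑ (λ k → 𝟙 (onConic? v w y k) *ℕ f) (Enumeration.list points)
      ≡⟨ ∑-*ʳ f _ (Enumeration.list points) ⟩
    #conic v w y *ℕ f ∎
    where
    open ℕ.≤-Reasoning
    _≟P_ = Enumeration._≟_ points
    y = x + - (w * v)
    κ : Mat2 F → Carrier × Carrier
    κ u = first-row (φ v u)
    counted : Mat2 F → ℕ
    counted u = 𝟙 (det F u ≟ 1#) *ℕ 𝟙 (trWord F v w u ≟ x)
    in-fibre : ∀ k u → 𝟙 (κ u ≟P k) *ℕ counted u ≤ℕ 𝟙 ((det F u ≟ 1#) ×-dec (φ v u ≟M first-row-matrix v w x k))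
    in-fibre k u = ℕ.≤-trans (ℕ.≤-reflexive (𝟙-×³ (κ u ≟P k) (det F u ≟ 1#) (trWord F v w u ≟ x)))
      (𝟙-mono ((κ u ≟P k) ×-dec ((det F u ≟ 1#) ×-dec (trWord F v w u ≟ x))) ((det F u ≟ 1#) ×-dec (φ v u ≟M first-row-matrix v w x k))
        (λ (κu≡k , det≡1 , tr≡x) → det≡1 , trans (φ-from-first-row v w x u det≡1 tr≡x) (cong (first-row-matrix v w x) κu≡k)))
    off-conic : ∀ k → ¬ OnConic v w y k → ∀ u → 𝟙 (κ u ≟P k) *ℕ counted u ≡ 0
    off-conic k off u = trans (𝟙-×³ (κ u ≟P k) (det F u ≟ 1#) (trWord F v w u ≟ x))
      (𝟙-no ((κ u ≟P k) ×-dec ((det F u ≟ 1#) ×-dec (trWord F v w u ≟ x)))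
        (λ (κu≡k , det≡1 , tr≡x) → off (subst (OnConic v w y) κu≡k (first-row-on-conic v w x u det≡1 tr≡x))))
    over-point : ∀ k → ∑M (λ u → 𝟙 (κ u ≟P k) *ℕ counted u) ≤ℕ 𝟙 (onConic? v w y k) *ℕ f
    over-point k = ∑≤𝟙* (allMat F) (onConic? v w y k)
      (λ _ → ℕ.≤-trans (∑-mono (allMat F) (in-fibre k)) (fibre≤f (first-row-matrix v w x k)))
      (off-conic k)

module Bounds (F : FiniteField) where

  open FiniteField F
  open import Data.Nat as ℕ using (ℕ) renaming (_+_ to _+ℕ_; _*_ to _*ℕ_; _≤_ to _≤ℕ_; _∸_ to _∸ℕ_)
  import Data.Nat.Properties as ℕ
  open import Data.Nat.Divisibility using (_∣_)
  open import Data.Nat.Tactic.RingSolver using (solve-∀)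
  open import Data.Product using (_×_; _,_)
  open import Data.Sum using (_⊎_; inj₁; inj₂)
  open import Data.Empty using (⊥-elim)
  open import Relation.Nullary using (¬_; Dec; yes; no)
  open import Relation.Binary.PropositionalEquality using (_≡_; _≢_; refl; sym; trans; cong; cong₂; subst; subst₂; module ≡-Reasoning)
  open import Function using (case_of_)
  open import Algebra.Bundles using (CommutativeRing)
  open FiniteSums
  open Enumerations
  open FieldFacts F
  open IntegerSolver F
  open MatrixEnumeration F
  open Conics F
  open ConicCounts F
  open Conjugation F
  open TraceCounts F
  open NatEstimates
  open CommutativeRing ring using (+-identityˡ)

  Admissible : Carrier → Carrier → Set
  Admissible v w = 2 ∣ size ⊎ (¬ (2 ∣ size) × ¬ ((v * v ≡ - four F) × (w * w ≡ - four F)) × ¬ ((v ≡ 0#) × (w ≡ 0#)))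

  fibre≤2q : ∀ v M → fibre v M ≤ℕ size *ℕ 2
  fibre≤2q v M = ℕ.≤-trans (fibre≤#centraliser v M) (#conic≤2q 0# v 0#)

  SmallFibres : Carrier → Set
  SmallFibres v = ∀ M → fibre v M ≤ℕ size +ℕ 2

  -- This holds when the centraliser conic K_{0,v,0} is nondegenerate, i.e. v² + 4 ≠ 0 ...
  small-fibres : ∀ v → v * v + four F ≢ 0# → SmallFibres v
  small-fibres v v²+4≢0 M = ℕ.≤-trans (fibre≤#centraliser v M) (#conic≤q+2 0# v 0# nondegenerate)
    where
    nondegenerate : discriminant 0# v 0# ≢ 0#
    nondegenerate disc≡0 = v²+4≢0 (begin
      v * v + four F                ≡⟨ solve 1 (λ v → v ⊗ v ⊕ (#1 ⊕ #1 ⊕ #1 ⊕ #1) ⊜ ⊝ Sym.discriminant #0 v #0) refl v ⟩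
      - discriminant 0# v 0#        ≡⟨ cong -_ disc≡0 ⟩
      - 0#                          ≡⟨ solve 0 (⊝ #0 ⊜ #0) refl ⟩
      0#                            ∎)
      where open ≡-Reasoning

  small-fibres-char2 : two ≡ 0# → SmallFibres 0#
  small-fibres-char2 two≡0 M = ℕ.≤-trans (fibre≤#centraliser 0# M) (ℕ.≤-trans (#conic≤q-char2 two≡0) (ℕ.m≤m+n size 2))

  square≡-4 : ∀ z → z * z + four F ≡ 0# → z * z ≡ - four F
  square≡-4 z e = begin
    z * z                            ≡⟨ solve 2 (λ z f → z ⊗ z ⊜ (z ⊗ z ⊕ f) ⊕ ⊝ f) refl z (four F) ⟩
    (z * z + four F) + - four F      ≡⟨ cong (_+ - four F) e ⟩
    0# + - four F                    ≡⟨ +-identityˡ _ ⟩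
    - four F                         ∎
    where open ≡-Reasoning

  char2-root : two ≡ 0# → ∀ z → z * z + four F ≡ 0# → z ≡ 0#
  char2-root two≡0 z e = square-zero z (begin
    z * z                            ≡⟨ solve 1 (λ z → z ⊗ z ⊜ (z ⊗ z ⊕ (#1 ⊕ #1 ⊕ #1 ⊕ #1)) ⊕ ⊝ (Sym.two ⊗ Sym.two)) refl z ⟩
    (z * z + four F) + - (two * two) ≡⟨ cong₂ (λ a t → a + - (t * t)) e two≡0 ⟩
    0# + - (0# * 0#)                 ≡⟨ solve 0 (#0 ⊕ ⊝ (#0 ⊗ #0) ⊜ #0) refl ⟩
    0#                               ∎)
    where open ≡-Reasoning

  small-fibres-one-of : ∀ v w → Admissible v w → SmallFibres v ⊎ SmallFibres w
  small-fibres-one-of v w admissible with (v * v + four F) ≟ 0# | (w * w + four F) ≟ 0# | two ≟ 0#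
  ... | no v²+4≢0 | _ | _ = inj₁ (small-fibres v v²+4≢0)
  ... | yes _ | no w²+4≢0 | _ = inj₂ (small-fibres w w²+4≢0)
  ... | yes v²+4≡0 | yes _ | yes two≡0 =
    inj₁ (subst SmallFibres (sym (char2-root two≡0 v v²+4≡0)) (small-fibres-char2 two≡0))
  ... | yes v²+4≡0 | yes w²+4≡0 | no two≢0 = ⊥-elim (case admissible of λ where
    (inj₁ 2∣q) → odd-order two≢0 2∣q
    (inj₂ (_ , not-both , _)) → not-both (square≡-4 v v²+4≡0 , square≡-4 w w²+4≡0))

  -- For fixed v, w, at most two values of x make K_{v,w,x−wv} degenerate:
  -- the discriminant is monic quadratic in x.
  Degenerate : Carrier → Carrier → Carrier → Set
  Degenerate v w x = discriminant v w (x + - (w * v)) ≡ 0#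

  degenerate? : ∀ v w x → Dec (Degenerate v w x)
  degenerate? v w x = discriminant v w (x + - (w * v)) ≟ 0#

  #degenerate≤2 : ∀ v w → Elements.count (degenerate? v w) ≤ℕ 2
  #degenerate≤2 v w = ℕ.≤-trans
    (∑-mono (elems F) (λ x → 𝟙-mono (degenerate? v w x) (quadratic? x) (λ e → trans (sym (as-quadratic x)) e)))
    (quadratic-roots (- (v * w)) (- (v * v) + - (w * w) + - four F))
    where
    quadratic? : ∀ x → Dec (x * x + - (v * w) * x + (- (v * v) + - (w * w) + - four F) ≡ 0#)
    quadratic? x = (x * x + - (v * w) * x + (- (v * v) + - (w * w) + - four F)) ≟ 0#
    as-quadratic : ∀ x → discriminant v w (x + - (w * v)) ≡ x * x + - (v * w) * x + (- (v * v) + - (w * w) + - four F)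
    as-quadratic x = solve 3 (λ v w x → Sym.discriminant v w (x ⊕ ⊝ (w ⊗ v)) ⊜
      x ⊗ x ⊕ ⊝ (v ⊗ w) ⊗ x ⊕ (⊝ (v ⊗ v) ⊕ ⊝ (w ⊗ w) ⊕ ⊝ (#1 ⊕ #1 ⊕ #1 ⊕ #1))) refl v w x

  N≤4q² : ∀ v w x → N v w x ≤ℕ (size *ℕ 2) *ℕ (size *ℕ 2)
  N≤4q² v w x = ℕ.≤-trans (N≤fibre·#conic v w x (size *ℕ 2) (fibre≤2q v))
                          (ℕ.*-monoˡ-≤ (size *ℕ 2) (#conic≤2q v w (x + - (w * v))))

  N≤[q+2]² : ∀ v w x → SmallFibres v → ¬ Degenerate v w x → N v w x ≤ℕ (size +ℕ 2) *ℕ (size +ℕ 2)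
  N≤[q+2]² v w x small nondegenerate = ℕ.≤-trans (N≤fibre·#conic v w x (size +ℕ 2) small)
                                                 (ℕ.*-monoˡ-≤ (size +ℕ 2) (#conic≤q+2 v w (x + - (w * v)) nondegenerate))

  N≤[q+2]2q : ∀ v w x → SmallFibres v → N v w x ≤ℕ (size +ℕ 2) *ℕ (size *ℕ 2)
  N≤[q+2]2q v w x small = ℕ.≤-trans (N≤fibre·#conic v w x (size +ℕ 2) small)
                                    (ℕ.≤-trans (ℕ.*-monoˡ-≤ (size +ℕ 2) (#conic≤2q v w (x + - (w * v))))
                                               (ℕ.≤-reflexive (ℕ.*-comm (size *ℕ 2) (size +ℕ 2))))

  open Estimates size |SL2| two≤size |SL2|-lower-bound

  excess : Carrier → Carrier → Carrier → ℕ
  excess v w x = size *ℕ N v w x ∸ℕ |SL2|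

  excess-bound : ∀ v w x → SmallFibres v → excess v w x ≤ℕ 7 *ℕ (size *ℕ size) +ℕ 𝟙 (degenerate? v w x) *ℕ (4 *ℕ (size *ℕ (size *ℕ size)))
  excess-bound v w x small = case degenerate? v w x of λ where
    (yes deg) → ℕ.≤-trans (excess≤4q³ (N v w x) (N≤[q+2]2q v w x small))
                          (ℕ.≤-trans (ℕ.≤-reflexive (sym (trans (cong (_*ℕ _) (𝟙-yes (degenerate? v w x) deg)) (ℕ.+-identityʳ _))))
                                     (ℕ.m≤n+m _ (7 *ℕ (size *ℕ size))))
    (no nondeg) → ℕ.≤-trans (excess≤7q² (N v w x) (N≤[q+2]² v w x small nondeg)) (ℕ.m≤m+n _ _)

  -- Summing: the excess is at most q · 7q² + 2 · 4q³ = 15q³.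
  ∑excess≤15q³ : ∀ v w → SmallFibres v → ∑F (excess v w) ≤ℕ 15 *ℕ (size *ℕ (size *ℕ size))
  ∑excess≤15q³ v w small = begin
    ∑F (excess v w)
      ≤⟨ ∑-mono (elems F) (λ x → excess-bound v w x small) ⟩
    ∑F (λ x → 7 *ℕ (size *ℕ size) +ℕ 𝟙 (degenerate? v w x) *ℕ (4 *ℕ (size *ℕ (size *ℕ size))))
      ≡⟨ trans (∑-+ _ _ (elems F)) (cong₂ _+ℕ_ (∑F-const _) (∑-*ʳ _ _ (elems F))) ⟩
    size *ℕ (7 *ℕ (size *ℕ size)) +ℕ Elements.count (degenerate? v w) *ℕ (4 *ℕ (size *ℕ (size *ℕ size)))
      ≤⟨ ℕ.+-monoʳ-≤ _ (ℕ.*-monoˡ-≤ _ (#degenerate≤2 v w)) ⟩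
    size *ℕ (7 *ℕ (size *ℕ size)) +ℕ 2 *ℕ (4 *ℕ (size *ℕ (size *ℕ size)))
      ≡⟨ collect size ⟩
    15 *ℕ (size *ℕ (size *ℕ size)) ∎
    where
    open ℕ.≤-Reasoning
    collect : ∀ q → q *ℕ (7 *ℕ (q *ℕ q)) +ℕ 2 *ℕ (4 *ℕ (q *ℕ (q *ℕ q))) ≡ 15 *ℕ (q *ℕ (q *ℕ q))
    collect = solve-∀

  -- If φ_w has small fibres, the excess for (v, w) is bounded using the symmetry N_{v,w} = N_{w,v}.
  ∑excess≤15q³-admissible : ∀ v w → Admissible v w → ∑F (excess v w) ≤ℕ 15 *ℕ (size *ℕ (size *ℕ size))
  ∑excess≤15q³-admissible v w admissible with small-fibres-one-of v w admissible
  ... | inj₁ small-v = ∑excess≤15q³ v w small-v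
  ... | inj₂ small-w = subst (_≤ℕ 15 *ℕ (size *ℕ (size *ℕ size)))
                            (∑-cong (elems F) (λ x → cong (λ n → size *ℕ n ∸ℕ |SL2|) (N-symmetric v w x)))
                            (∑excess≤15q³ w v small-w)

  -- Part (1): every value x has probability N(x)/|SL(2,q)| ≤ 30/q.
  point-bound : ∀ v w x → countD F v w x *ℕ size ≤ℕ 30 *ℕ orderSL2 F
  point-bound v w x = subst₂ (λ n S → n *ℕ size ≤ℕ 30 *ℕ S) (sym (countD≡N v w x)) (sym orderSL2≡|SL2|)
    (ℕ.≤-trans (n·q≤8S (N v w x) (N≤4q² v w x)) (ℕ.*-monoˡ-≤ |SL2| (ℕ.m≤m+n 8 22)))

  -- Part (2): Σ_x |q N(x) − |SL(2,q)|| ≤ 60 |SL(2,q)|, i.e. total variation ≤ 30/q.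
  scaledTV-bound : ∀ v w → Admissible v w → scaledTV F v w ≤ℕ 60 *ℕ orderSL2 F
  scaledTV-bound v w admissible = begin
    scaledTV F v w
      ≡⟨ ∑-cong (elems F) (λ x → cong₂ (λ n S → ℕ.∣ size *ℕ n - S ∣) (countD≡N v w x) orderSL2≡|SL2|) ⟩
    ∑F (λ x → ℕ.∣ size *ℕ N v w x - |SL2| ∣)
      ≡⟨ ∑∣-∣≡2∑∸ (elems F) (λ x → size *ℕ N v w x) |SL2| same-total ⟩
    2 *ℕ ∑F (excess v w)
      ≤⟨ ℕ.*-monoʳ-≤ 2 (∑excess≤15q³-admissible v w admissible) ⟩
    2 *ℕ (15 *ℕ (size *ℕ (size *ℕ size)))
      ≤⟨ ℕ.*-monoʳ-≤ 2 (ℕ.*-monoʳ-≤ 15 q³≤2S) ⟩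
    2 *ℕ (15 *ℕ (2 *ℕ |SL2|))
      ≡⟨ regroup |SL2| ⟩
    60 *ℕ |SL2|
      ≡⟨ cong (60 *ℕ_) (sym orderSL2≡|SL2|) ⟩
    60 *ℕ orderSL2 F ∎
    where
    open ℕ.≤-Reasoning
    regroup : ∀ S → 2 *ℕ (15 *ℕ (2 *ℕ S)) ≡ 60 *ℕ S
    regroup = solve-∀
    same-total : ∑F (λ x → size *ℕ N v w x) ≡ ∑F (λ _ → |SL2|)
    same-total = trans (∑-*ˡ size (N v w) (elems F)) (trans (cong (size *ℕ_) (∑N≡|SL2| v w)) (sym (∑F-const |SL2|)))


lemma5p5 : Σ ℕ λ C → Σ ℕ λ a → Σ ℕ λ b → 1 ≤ C × 1 ≤ a × 1 ≤ b ×
    ((F : FiniteField) → let open FiniteField F in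
      (v w : Carrier) →
      (2 ∣ size ⊎ (¬ (2 ∣ size) × ¬ ((v * v ≡ - four F) × (w * w ≡ - four F)) × ¬ ((v ≡ 0#) × (w ≡ 0#)))) →
      ((x : Carrier) → countD F v w x ℕ.* size ≤ C ℕ.* orderSL2 F)
      × (scaledTV F v w ^ b ℕ.* size ^ a ≤ (2 ℕ.* size ℕ.* orderSL2 F ℕ.* C) ^ b))
lemma5p5 = 30 , 1 , 1 , s≤s z≤n , s≤s z≤n , s≤s z≤n , λ F v w admissible →
  let open Bounds F in
  point-bound v w , NatEstimates.scaled-form (scaledTV F v w) (FiniteField.size F) (orderSL2 F) (scaledTV-bound v w admissible)
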